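{- Let $q$ be a prime power, let $n \geq 2$ and $1 \leq d \leq n-1$ be integers, and let $\ell \in \mathbb{N}$ with $1 \leq \ell < q$. Let $g_1,\dots,g_{n-d} \in \mathbb{F}_q[t_1,\dots,t_d]$ be polynomials of degree $\ell$. Let $\rho \in (\mathbb{F}_q \setminus \{0\})^{n-d}$ and $a \in \mathbb{F}_q^n$, and let \[C = \{a + (t, \rho_1 g_1(t), \dots, \rho_{n-d} g_{n-d}(t)) : t \in \mathbb{F}_q^{d}\}.\] Let $k, D, M \in \mathbb{N}$ be such that $\ell(D-\omega) < (M-\omega)q$ for all integers $0 \leq \omega < k$. Suppose that $f \in \mathbb{F}_q[x_1,\dots,x_n]$ is a nonzero polynomial of degree at most $D$ vanishing on $C$ with multiplicity $M$. For $\beta \in \mathbb{Z}_{\geq 0}^n$ let $f^{(\beta)}$ be the $\beta$-th Hasse derivative of $f$ and let \[f_{\beta,\rho}(s) := f^{(\beta)}\bigl(a + (s, \rho_1 g_1(s), \dots, \rho_{n-d} g_{n-d}(s))\bigr) \in \mathbb{F}_q[s_1,\dots,s_d].\] Then for every $\beta \in \mathbb{Z}_{\geq 0}^n$ with $|\beta| < k$, $f_{\beta,\rho}$ is the zero polynomial.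
   Context: For $\beta = (\beta_1,\dots,\beta_m) \in \mathbb{Z}_{\geq 0}^m$, $|\beta| = \sum_i \beta_i$ and $y^\beta = \prod_i y_i^{\beta_i}$. For $f \in \mathbb{F}_q[x_1,\dots,x_m]$ and $\beta \in \mathbb{Z}_{\geq 0}^m$, the $\beta$-th Hasse derivative $f^{(\beta)}$ is the coefficient of $y^\beta$ in $f(x+y)$, i.e. $f(x+y) = \sum_\beta f^{(\beta)}(x) y^\beta$. The multiplicity of $f$ at $a \in \mathbb{F}_q^m$ is $\mathrm{mult}(f,a) = \sup\{M \in \mathbb{Z}_{\geq 0} : f^{(\beta)}(a) = 0 \text{ for all } \beta \text{ with } |\beta| < M\}$; $f$ vanishes on a set $A$ with multiplicity $M$ if $\mathrm{mult}(f,a) \geq M$ for all $a \in A$. A polynomial is the zero polynomial if all its coefficients are zero. -}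

module Defs where

open import Level using (Level; _⊔_) renaming (suc to lsuc)
open import Data.Nat as ℕ using (ℕ; zero; suc; _<_; _≤_)
open import Data.Nat.Primality using (Prime)
open import Data.Fin using (Fin)
open import Data.Vec as V using (Vec; []; _∷_; _++_; lookup; tabulate; zipWith; splitAt)
open import Data.Vec.Properties using (≡-dec)
open import Data.List as L using (List; []; _∷_)
open import Data.Product using (Σ; ∃; ∃-syntax; _×_; _,_; proj₁; proj₂)
open import Relation.Nullary using (¬_; yes; no)
open import Relation.Binary.PropositionalEquality using (_≡_)
open import Algebra.Bundles using (CommutativeRing)

IsPrimePower : ℕ → Set
IsPrimePower q = ∃[ p ] ∃[ e ] (Prime p × q ≡ p ℕ.^ suc e)

record FiniteField (c ℓ : Level) : Set (lsuc (c ⊔ ℓ)) where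
  field
    cring : CommutativeRing c ℓ
  open CommutativeRing cring
  field
    0≉1     : ¬ (0# ≈ 1#)
    inverse : ∀ x → ¬ (x ≈ 0#) → ∃[ y ] (x * y ≈ 1#)
    size    : ℕ
    elems   : Vec Carrier size
    complete : ∀ x → ∃[ i ] (x ≈ lookup elems i)
    distinct : ∀ i j → lookup elems i ≈ lookup elems j → i ≡ j

-- A polynomial is a finite formal sum of terms c·x^α, represented as a
-- list of (exponent vector α, coefficient c). Its coefficient at α is
-- the sum of the coefficients of all terms with exponent α.

module Polynomials {c ℓ} (R : CommutativeRing c ℓ) where
  open CommutativeRing R

  Monomial : ℕ → Set
  Monomial m = Vec ℕ m

  Poly : ℕ → Set c
  Poly m = List (Monomial m × Carrier)

  ∣_∣ₘ : ∀ {m} → Monomial m → ℕ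
  ∣ α ∣ₘ = V.sum α

  sumR : List Carrier → Carrier
  sumR = L.foldr _+_ 0#

  _^ᴿ_ : Carrier → ℕ → Carrier
  x ^ᴿ zero = 1#
  x ^ᴿ suc n = x * (x ^ᴿ n)

  coeff : ∀ {m} → Poly m → Monomial m → Carrier
  coeff [] α = 0#
  coeff ((β , b) ∷ p) α with ≡-dec ℕ._≟_ β α
  ... | yes _ = b + coeff p α
  ... | no  _ = coeff p α

  IsZero : ∀ {m} → Poly m → Set ℓ
  IsZero p = ∀ α → coeff p α ≈ 0#

  DegreeAtMost : ∀ {m} → Poly m → ℕ → Set ℓ
  DegreeAtMost p D = ∀ α → ¬ (coeff p α ≈ 0#) → ∣ α ∣ₘ ≤ D

  HasDegree : ∀ {m} → Poly m → ℕ → Set ℓ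
  HasDegree p D = DegreeAtMost p D × ∃[ α ] (∣ α ∣ₘ ≡ D × ¬ (coeff p α ≈ 0#))

  const : ∀ {m} → Carrier → Poly m
  const x = (V.replicate _ 0 , x) ∷ []

  var : ∀ {m} → Fin m → Poly m
  var i = (tabulate (λ j → unit i j) , 1#) ∷ []
    where
      open import Data.Fin using (_≟_)
      unit : ∀ {m} → Fin m → Fin m → ℕ
      unit i j with i ≟ j
      ... | yes _ = 1
      ... | no  _ = 0

  _+ₚ_ : ∀ {m} → Poly m → Poly m → Poly m
  p +ₚ r = p L.++ r

  _*ₚ_ : ∀ {m} → Poly m → Poly m → Poly m
  p *ₚ r = L.concatMap (λ { (α , a) → L.map (λ { (β , b) → (zipWith ℕ._+_ α β , a * b) }) r }) p

  _^ₚ_ : ∀ {m} → Poly m → ℕ → Poly m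
  p ^ₚ zero = const 1#
  p ^ₚ suc n = p *ₚ (p ^ₚ n)

  eval : ∀ {m} → Poly m → Vec Carrier m → Carrier
  eval p x = sumR (L.map (λ { (α , a) → a * V.foldr _ _*_ 1# (zipWith _^ᴿ_ x α) }) p)

  subst : ∀ {m k} → Poly m → Vec (Poly k) m → Poly k
  subst p σ = L.concatMap (λ { (α , a) →
      const a *ₚ V.foldr _ _*ₚ_ (const 1#) (zipWith _^ₚ_ σ α) }) p

  -- Hasse derivative: f(x+y) = Σ_β f^(β)(x) y^β.
  -- shift f = f(x+y) as a polynomial in the 2m variables (x , y).
  shift : ∀ {m} → Poly m → Poly (m ℕ.+ m)
  shift {m} f = subst f (tabulate (λ i → var (i Data.Fin.↑ˡ m) +ₚ var (m Data.Fin.↑ʳ i)))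
    where import Data.Fin

  coeffʸ : ∀ {m} → Poly (m ℕ.+ m) → Monomial m → Poly m
  coeffʸ {m} [] β = []
  coeffʸ {m} ((γ , b) ∷ p) β with splitAt m γ
  ... | (αx , αy , _) with ≡-dec ℕ._≟_ αy β
  ...   | yes _ = (αx , b) ∷ coeffʸ p β
  ...   | no  _ = coeffʸ p β

  hasse : ∀ {m} → Poly m → Monomial m → Poly m
  hasse f β = coeffʸ (shift f) β

  MultAtLeast : ∀ {m} → Poly m → Vec Carrier m → ℕ → Set ℓ
  MultAtLeast f a M = ∀ β → ∣ β ∣ₘ < M → eval (hasse f β) a ≈ 0#

{-# OPTIONS --safe #-}
-- Let σ be the parametrisation of C and P = f^(β) ∘ σ, with ω = |β|. Each σᵢ has degree ≤ ℓ, so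
-- deg P ≤ ℓ(D - ω). Hasse derivatives commute with translation and composition does not lower
-- multiplicity, so P vanishes to order M - ω at every point of F_q^d. By the Schwartz–Zippel lemma
-- with multiplicities (a polynomial of degree δ vanishing to order r on S^d is zero if δ < r|S|,
-- proved by slicing along x₁ and counting roots of univariate polynomials) P = 0, since
-- ℓ(D - ω) < (M - ω)q. If D < ω then f^(β) = 0 already.
module Submission where

open import Defs
open import Algebra.Bundles using (CommutativeRing)
open import Data.Nat using (ℕ; _≤_; _<_; _+_)
import Data.Nat as N
import Data.Nat.Properties as NP
open import Data.Nat.DivMod using (_/_; m/n*n≤m; m≡m%n+[m/n]*n; m%n<n)
import Data.Vec as V
open import Data.Vec using (Vec; lookup; zipWith; tabulate; _++_; map)
import Data.Vec.Properties as VP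
open VP using (≡-dec)
import Data.List as L
import Data.List.Properties as LP
open import Data.List using (List; []; _∷_)
open import Data.Product using (∃; _×_; _,_; proj₁; proj₂)
open import Data.Sum using (_⊎_; inj₁; inj₂)
open import Data.Empty using (⊥-elim)
open import Relation.Nullary using (¬_; yes; no; Dec)
import Relation.Binary.PropositionalEquality as Eq
open Eq using (_≡_)
import Data.Integer as ℤ
import Data.Integer.Properties as ZP
open import Data.Fin using (Fin)
import Data.Fin as Fn
import Data.Fin.Properties as FnP
import Relation.Binary.Reasoning.Setoid as SetoidReasoning
open import Relation.Binary.Bundles using (Setoid)
open import Relation.Binary.Definitions using (tri<; tri≈; tri>)
open import Algebra.Definitions using (AlmostLeftCancellative)

m<o∸n⇒m+n<o : ∀ {m n o} → m < o N.∸ n → m + n < o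
m<o∸n⇒m+n<o {m} {N.zero}  {o}       m<o = Eq.subst (_< o) (Eq.sym (NP.+-identityʳ m)) m<o
m<o∸n⇒m+n<o {m} {N.suc n} {N.suc o} m<o = Eq.subst (_< N.suc o) (Eq.sym (NP.+-suc m n)) (N.s≤s (m<o∸n⇒m+n<o m<o))

m∸n<o⇒m<o+n : ∀ {m n o} → m N.∸ n < o → m < o + n
m∸n<o⇒m<o+n {m} {n} {o} m∸n<o =
  NP.≤-<-trans (NP.m≤n+m∸n m n) (Eq.subst (n + (m N.∸ n) <_) (NP.+-comm n o) (NP.+-monoʳ-< n m∸n<o))

quotient-bounds : ∀ t k → 0 < k → ∃ λ u → u N.* k ≤ t × t < N.suc u N.* k
quotient-bounds t k@(N.suc _) _ = t / k , m/n*n≤m t k ,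
  Eq.subst (_< N.suc (t / k) N.* k) (Eq.sym (m≡m%n+[m/n]*n t k)) (NP.+-monoˡ-< (t / k N.* k) (m%n<n t k))

ℤ-bound⇒ℕ-bound : ∀ l D M ω q → ω ≤ D →
  (ℤ.+ l) ℤ.* ((ℤ.+ D) ℤ.- (ℤ.+ ω)) ℤ.< ((ℤ.+ M) ℤ.- (ℤ.+ ω)) ℤ.* (ℤ.+ q) →
  l N.* (D N.∸ ω) < (M N.∸ ω) N.* q
ℤ-bound⇒ℕ-bound l D M ω q ω≤D bound with ω N.≤? M
... | yes ω≤M = ZP.drop‿+<+ (Eq.subst₂ ℤ._<_ lhs≡ rhs≡ bound)
  where
    difference : ∀ {m} → ω ≤ m → (ℤ.+ m) ℤ.- (ℤ.+ ω) ≡ ℤ.+ (m N.∸ ω)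
    difference {m} ω≤m = Eq.trans (ZP.m-n≡m⊖n m ω) (ZP.⊖-≥ ω≤m)
    lhs≡ : (ℤ.+ l) ℤ.* ((ℤ.+ D) ℤ.- (ℤ.+ ω)) ≡ ℤ.+ (l N.* (D N.∸ ω))
    lhs≡ = Eq.trans (Eq.cong (ℤ.+ l ℤ.*_) (difference ω≤D)) (Eq.sym (ZP.pos-* l (D N.∸ ω)))
    rhs≡ : ((ℤ.+ M) ℤ.- (ℤ.+ ω)) ℤ.* (ℤ.+ q) ≡ ℤ.+ ((M N.∸ ω) N.* q)
    rhs≡ = Eq.trans (Eq.cong (ℤ._* ℤ.+ q) (difference ω≤M)) (Eq.sym (ZP.pos-* (M N.∸ ω) q))
... | no ω≰M = ⊥-elim (ZP.<-irrefl Eq.refl (ZP.≤-<-trans 0≤lhs (ZP.<-≤-trans bound rhs≤0)))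
  where
    0≤lhs : ℤ.+ 0 ℤ.≤ (ℤ.+ l) ℤ.* ((ℤ.+ D) ℤ.- (ℤ.+ ω))
    0≤lhs = Eq.subst (ℤ.+ 0 ℤ.≤_)
      (Eq.sym (Eq.trans (Eq.cong (ℤ.+ l ℤ.*_) (Eq.trans (ZP.m-n≡m⊖n D ω) (ZP.⊖-≥ ω≤D))) (Eq.sym (ZP.pos-* l (D N.∸ ω)))))
      (ℤ.+≤+ N.z≤n)
    rhs≤0 : ((ℤ.+ M) ℤ.- (ℤ.+ ω)) ℤ.* (ℤ.+ q) ℤ.≤ ℤ.+ 0
    rhs≤0 = ZP.*-monoʳ-≤-nonNeg (ℤ.+ q) (ZP.i≤j⇒i-j≤0 (ℤ.+≤+ (NP.<⇒≤ (NP.≰⇒> ω≰M))))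

lookup-++-pointwise : ∀ {a b r} {A : Set a} {B : Set b} (R : A → B → Set r) {m n}
  (u : Vec A m) (v : Vec B m) (u′ : Vec A n) (v′ : Vec B n) →
  (∀ i → R (lookup u i) (lookup v i)) → (∀ i → R (lookup u′ i) (lookup v′ i)) →
  ∀ i → R (lookup (u ++ u′) i) (lookup (v ++ v′) i)
lookup-++-pointwise R V.[]       V.[]       u′ v′ R-uv R-u′v′ i          = R-u′v′ i
lookup-++-pointwise R (x V.∷ u) (y V.∷ v) u′ v′ R-uv R-u′v′ Fn.zero    = R-uv Fn.zero
lookup-++-pointwise R (x V.∷ u) (y V.∷ v) u′ v′ R-uv R-u′v′ (Fn.suc i) =
  lookup-++-pointwise R u v u′ v′ (λ j → R-uv (Fn.suc j)) R-u′v′ i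

module PolynomialAlgebra {c ℓ} (R : CommutativeRing c ℓ) where
  open CommutativeRing R renaming (_+_ to _⊕_) hiding (zero)
  open Polynomials R
  open import Algebra.Properties.Ring ring using (-‿distribˡ-*; -0#≈0#; -‿+-comm; x∙y⁻¹≈ε⇒x≈y)
  open import Algebra.Properties.CommutativeSemigroup +-commutativeSemigroup
    using () renaming (interchange to ⊕-interchange; x∙yz≈y∙xz to ⊕-left-comm)
  open import Algebra.Properties.CommutativeSemigroup *-commutativeSemigroup
    using () renaming (interchange to *-interchange)
  module ≈-Reasoning = SetoidReasoning setoid

  ∑ : ∀ {a} {A : Set a} → List A → (A → Carrier) → Carrier
  ∑ xs f = sumR (L.map f xs)

  ∑-cong : ∀ {a} {A : Set a} (xs : List A) {f g : A → Carrier} →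
           (∀ x → f x ≈ g x) → ∑ xs f ≈ ∑ xs g
  ∑-cong []       f≈g = refl
  ∑-cong (x ∷ xs) f≈g = +-cong (f≈g x) (∑-cong xs f≈g)

  ∑-++ : ∀ {a} {A : Set a} (xs ys : List A) (f : A → Carrier) →
         ∑ (xs L.++ ys) f ≈ ∑ xs f ⊕ ∑ ys f
  ∑-++ []       ys f = sym (+-identityˡ _)
  ∑-++ (x ∷ xs) ys f = trans (+-congˡ (∑-++ xs ys f)) (sym (+-assoc _ _ _))

  ∑-⊕ : ∀ {a} {A : Set a} (xs : List A) (f g : A → Carrier) →
        ∑ xs (λ x → f x ⊕ g x) ≈ ∑ xs f ⊕ ∑ xs g
  ∑-⊕ []       f g = sym (+-identityˡ _)
  ∑-⊕ (x ∷ xs) f g = trans (+-congˡ (∑-⊕ xs f g)) (⊕-interchange _ _ _ _)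

  *-distribˡ-∑ : ∀ {a} {A : Set a} (xs : List A) (k : Carrier) (f : A → Carrier) →
                 k * ∑ xs f ≈ ∑ xs (λ x → k * f x)
  *-distribˡ-∑ []       k f = zeroʳ k
  *-distribˡ-∑ (x ∷ xs) k f = trans (distribˡ k _ _) (+-congˡ (*-distribˡ-∑ xs k f))

  *-distribʳ-∑ : ∀ {a} {A : Set a} (xs : List A) (k : Carrier) (f : A → Carrier) →
                 ∑ xs f * k ≈ ∑ xs (λ x → f x * k)
  *-distribʳ-∑ xs k f =
    trans (*-comm _ k) (trans (*-distribˡ-∑ xs k f) (∑-cong xs (λ x → *-comm k (f x))))

  ∑-zero : ∀ {a} {A : Set a} (xs : List A) {f : A → Carrier} →
           (∀ x → f x ≈ 0#) → ∑ xs f ≈ 0#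
  ∑-zero []       f≈0 = refl
  ∑-zero (x ∷ xs) f≈0 = trans (+-cong (f≈0 x) (∑-zero xs f≈0)) (+-identityˡ 0#)

  ∑-map : ∀ {a b} {A : Set a} {B : Set b} (xs : List A) (g : A → B) (f : B → Carrier) →
          ∑ (L.map g xs) f ≈ ∑ xs (λ x → f (g x))
  ∑-map []       g f = refl
  ∑-map (x ∷ xs) g f = +-congˡ (∑-map xs g f)

  ∑-concatMap : ∀ {a b} {A : Set a} {B : Set b} (xs : List A) (g : A → List B) (f : B → Carrier) →
                ∑ (L.concatMap g xs) f ≈ ∑ xs (λ x → ∑ (g x) f)
  ∑-concatMap []       g f = refl
  ∑-concatMap (x ∷ xs) g f =
    trans (∑-++ (g x) (L.concatMap g xs) f) (+-congˡ (∑-concatMap xs g f))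

  ∑-comm : ∀ {a b} {A : Set a} {B : Set b} (xs : List A) (ys : List B) (f : A → B → Carrier) →
           ∑ xs (λ x → ∑ ys (f x)) ≈ ∑ ys (λ y → ∑ xs (λ x → f x y))
  ∑-comm []       ys f = sym (∑-zero ys (λ _ → refl))
  ∑-comm (x ∷ xs) ys f =
    trans (+-congˡ (∑-comm xs ys f)) (sym (∑-⊕ ys (f x) (λ y → ∑ xs (λ x → f x y))))

  kron : ∀ {m} → Monomial m → Monomial m → Carrier → Carrier
  kron β α b with ≡-dec N._≟_ β α
  ... | yes _ = b
  ... | no  _ = 0#

  kron-≡ : ∀ {m} {β α : Monomial m} → β ≡ α → ∀ b → kron β α b ≈ b
  kron-≡ {β = β} Eq.refl b with ≡-dec N._≟_ β β
  ... | yes _  = refl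
  ... | no β≢β = ⊥-elim (β≢β Eq.refl)

  kron-≢ : ∀ {m} {β α : Monomial m} b → ¬ β ≡ α → kron β α b ≈ 0#
  kron-≢ {β = β} {α} b β≢α with ≡-dec N._≟_ β α
  ... | yes β≡α = ⊥-elim (β≢α β≡α)
  ... | no  _   = refl

  kron-cong : ∀ {m} {β β′ α : Monomial m} {b b′} → β ≡ β′ → b ≈ b′ → kron β α b ≈ kron β′ α b′
  kron-cong {β = β} {α = α} Eq.refl b≈b′ with ≡-dec N._≟_ β α
  ... | yes _ = b≈b′
  ... | no  _ = refl

  kron-* : ∀ {m} (β α : Monomial m) a b → kron β α (a * b) ≈ a * kron β α b
  kron-* β α a b with ≡-dec N._≟_ β α
  ... | yes _ = refl
  ... | no  _ = sym (zeroʳ a)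

  kron-*-1# : ∀ {m} (β α : Monomial m) b → b * kron β α 1# ≈ kron β α b
  kron-*-1# β α b = trans (sym (kron-* β α b 1#)) (kron-cong {β = β} Eq.refl (*-identityʳ b))

  kron-⊕ : ∀ {m} (β α : Monomial m) a b → kron β α (a ⊕ b) ≈ kron β α a ⊕ kron β α b
  kron-⊕ β α a b with ≡-dec N._≟_ β α
  ... | yes _ = refl
  ... | no  _ = sym (+-identityˡ 0#)

  kron-0# : ∀ {m} (β α : Monomial m) → kron β α 0# ≈ 0#
  kron-0# β α with ≡-dec N._≟_ β α
  ... | yes _ = refl
  ... | no  _ = refl

  kron-- : ∀ {m} (β α : Monomial m) b → kron β α (- b) ≈ - kron β α b
  kron-- β α b with ≡-dec N._≟_ β α
  ... | yes _ = refl
  ... | no  _ = sym -0#≈0#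

  kron-∣∣ : ∀ {m} (β α : Monomial m) b → ¬ ∣ β ∣ₘ ≡ ∣ α ∣ₘ → kron β α b ≈ 0#
  kron-∣∣ β α b ∣β∣≢∣α∣ = kron-≢ {β = β} {α = α} b (λ β≡α → ∣β∣≢∣α∣ (Eq.cong ∣_∣ₘ β≡α))

  kron-++ : ∀ {m m′} (x α : Monomial m) (y β : Monomial m′) b →
            kron (x ++ y) (α ++ β) b ≈ kron x α (kron y β b)
  kron-++ x α y β b with ≡-dec N._≟_ x α | ≡-dec N._≟_ y β
  ... | yes Eq.refl | yes Eq.refl = kron-≡ {β = x ++ y} Eq.refl b
  ... | no x≢α      | _           = kron-≢ {β = x ++ y} b (λ eq → x≢α (VP.++-injectiveˡ x α eq))
  ... | yes Eq.refl | no y≢β      = kron-≢ {β = x ++ y} b (λ eq → y≢β (VP.++-injectiveʳ x x eq))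

  kron-∷ : ∀ {m} i (γ′ γ : Monomial m) b → kron γ′ γ b ≈ kron (i V.∷ γ′) (i V.∷ γ) b
  kron-∷ i γ′ γ b with ≡-dec N._≟_ γ′ γ | ≡-dec N._≟_ (i V.∷ γ′) (i V.∷ γ)
  ... | yes _     | yes _ = refl
  ... | no  _     | no  _ = refl
  ... | yes γ′≡γ  | no ne = ⊥-elim (ne (Eq.cong (i V.∷_) γ′≡γ))
  ... | no γ′≢γ   | yes e = ⊥-elim (γ′≢γ (VP.∷-injectiveʳ e))

  kron-*-kron : ∀ {m m′} (x α : Monomial m) (y β : Monomial m′) a b →
                kron x α (kron y β (a * b)) ≈ kron x α a * kron y β b
  kron-*-kron x α y β a b with ≡-dec N._≟_ x α | ≡-dec N._≟_ y β
  ... | yes _ | yes _ = refl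
  ... | yes _ | no  _ = sym (zeroʳ a)
  ... | no  _ | _     = sym (zeroˡ _)

  coeff-∷ : ∀ {m} β b (p : Poly m) α → coeff ((β , b) ∷ p) α ≈ kron β α b ⊕ coeff p α
  coeff-∷ β b p α with ≡-dec N._≟_ β α
  ... | yes _ = refl
  ... | no  _ = sym (+-identityˡ _)

  coeff-singleton : ∀ {m} β b (α : Monomial m) → coeff ((β , b) ∷ []) α ≈ kron β α b
  coeff-singleton β b α = trans (coeff-∷ β b [] α) (+-identityʳ _)

  coeff≈∑ : ∀ {m} (p : Poly m) α → coeff p α ≈ ∑ p (λ t → kron (proj₁ t) α (proj₂ t))
  coeff≈∑ []            α = refl
  coeff≈∑ ((β , b) ∷ p) α = trans (coeff-∷ β b p α) (+-congˡ (coeff≈∑ p α))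

  coeff-++ : ∀ {m} (p r : Poly m) α → coeff (p L.++ r) α ≈ coeff p α ⊕ coeff r α
  coeff-++ p r α = begin
    coeff (p L.++ r) α                                    ≈⟨ coeff≈∑ (p L.++ r) α ⟩
    ∑ (p L.++ r) _                                        ≈⟨ ∑-++ p r _ ⟩
    ∑ p _ ⊕ ∑ r _                                         ≈⟨ +-cong (coeff≈∑ p α) (coeff≈∑ r α) ⟨
    coeff p α ⊕ coeff r α                                 ∎
    where open ≈-Reasoning

  coeff-concatMap : ∀ {a m} {A : Set a} (xs : List A) (g : A → Poly m) α →
                    coeff (L.concatMap g xs) α ≈ ∑ xs (λ x → coeff (g x) α)
  coeff-concatMap []       g α = refl
  coeff-concatMap (x ∷ xs) g α = trans (coeff-++ (g x) _ α) (+-congˡ (coeff-concatMap xs g α))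

  -- Coefficient-level facts are proved through the pairing ⟨ p , h ⟩ = Σ b·h(β) over the terms
  -- (β , b) of p: it is linear in p and, by pairing-cong, depends only on the coefficients of p.
  ⟨_,_⟩ : ∀ {m} → Poly m → (Monomial m → Carrier) → Carrier
  ⟨ p , h ⟩ = ∑ p (λ t → proj₂ t * h (proj₁ t))

  dropMonomial : ∀ {m} → Monomial m → Poly m → Poly m
  dropMonomial β [] = []
  dropMonomial β ((γ , b) ∷ p) with ≡-dec N._≟_ γ β
  ... | yes _ = dropMonomial β p
  ... | no  _ = (γ , b) ∷ dropMonomial β p

  coeff-dropMonomial-≡ : ∀ {m} β (p : Poly m) → coeff (dropMonomial β p) β ≈ 0#
  coeff-dropMonomial-≡ β [] = refl
  coeff-dropMonomial-≡ β ((γ , b) ∷ p) with ≡-dec N._≟_ γ β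
  ... | yes _   = coeff-dropMonomial-≡ β p
  ... | no  γ≢β = begin
    coeff ((γ , b) ∷ dropMonomial β p) β ≈⟨ coeff-∷ γ b _ β ⟩
    kron γ β b ⊕ coeff (dropMonomial β p) β ≈⟨ +-cong (kron-≢ b γ≢β) (coeff-dropMonomial-≡ β p) ⟩
    0# ⊕ 0#                                 ≈⟨ +-identityˡ 0# ⟩
    0#                                      ∎
    where open ≈-Reasoning

  coeff-dropMonomial-≢ : ∀ {m} β α (p : Poly m) → ¬ α ≡ β → coeff (dropMonomial β p) α ≈ coeff p α
  coeff-dropMonomial-≢ β α [] α≢β = refl
  coeff-dropMonomial-≢ β α ((γ , b) ∷ p) α≢β with ≡-dec N._≟_ γ β
  ... | yes Eq.refl = begin
    coeff (dropMonomial γ p) α ≈⟨ coeff-dropMonomial-≢ γ α p α≢β ⟩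
    coeff p α                  ≈⟨ +-identityˡ _ ⟨
    0# ⊕ coeff p α             ≈⟨ +-congʳ (kron-≢ b (λ γ≡α → α≢β (Eq.sym γ≡α))) ⟨
    kron γ α b ⊕ coeff p α     ≈⟨ coeff-∷ γ b p α ⟨
    coeff ((γ , b) ∷ p) α      ∎
    where open ≈-Reasoning
  ... | no _ = begin
    coeff ((γ , b) ∷ dropMonomial β p) α ≈⟨ coeff-∷ γ b _ α ⟩
    kron γ α b ⊕ coeff (dropMonomial β p) α ≈⟨ +-congˡ (coeff-dropMonomial-≢ β α p α≢β) ⟩
    kron γ α b ⊕ coeff p α ≈⟨ coeff-∷ γ b p α ⟨
    coeff ((γ , b) ∷ p) α ∎
    where open ≈-Reasoning

  length-dropMonomial-∷ : ∀ {m} β b (p : Poly m) → L.length (dropMonomial β ((β , b) ∷ p)) ≤ L.length p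
  length-dropMonomial-∷ β b p with ≡-dec N._≟_ β β
  ... | no β≢β = ⊥-elim (β≢β Eq.refl)
  ... | yes _  = length-dropMonomial β p
    where
      length-dropMonomial : ∀ {m} β (p : Poly m) → L.length (dropMonomial β p) ≤ L.length p
      length-dropMonomial β [] = N.z≤n
      length-dropMonomial β ((γ , b) ∷ p) with ≡-dec N._≟_ γ β
      ... | yes _ = NP.m≤n⇒m≤1+n (length-dropMonomial β p)
      ... | no  _ = N.s≤s (length-dropMonomial β p)

  pairing-extract : ∀ {m} β (p : Poly m) h → ⟨ p , h ⟩ ≈ coeff p β * h β ⊕ ⟨ dropMonomial β p , h ⟩
  pairing-extract β [] h = sym (trans (+-congʳ (zeroˡ _)) (+-identityˡ _))
  pairing-extract β ((γ , b) ∷ p) h with ≡-dec N._≟_ γ β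
  ... | yes Eq.refl = begin
    b * h γ ⊕ ⟨ p , h ⟩                                       ≈⟨ +-congˡ (pairing-extract β p h) ⟩
    b * h γ ⊕ (coeff p β * h β ⊕ ⟨ dropMonomial β p , h ⟩)   ≈⟨ +-assoc _ _ _ ⟨
    (b * h γ ⊕ coeff p β * h β) ⊕ ⟨ dropMonomial β p , h ⟩   ≈⟨ +-congʳ (distribʳ _ _ _) ⟨
    (b ⊕ coeff p β) * h β ⊕ ⟨ dropMonomial β p , h ⟩         ∎
    where open ≈-Reasoning
  ... | no _ = trans (+-congˡ (pairing-extract β p h)) (⊕-left-comm _ _ _)

  -- The list representation may repeat exponents, so this needs an induction on
  -- the number of terms, removing all terms of one exponent at a time.
  pairing-vanishes : ∀ {m} (p : Poly m) h → (∀ α → coeff p α ≈ 0# ⊎ h α ≈ 0#) → ⟨ p , h ⟩ ≈ 0#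
  pairing-vanishes p h = go (L.length p) p NP.≤-refl
    where
      open ≈-Reasoning
      go : ∀ n p → L.length p ≤ n → (∀ α → coeff p α ≈ 0# ⊎ h α ≈ 0#) → ⟨ p , h ⟩ ≈ 0#
      go n [] _ _ = refl
      go (N.suc n) p@((β , b) ∷ p′) (N.s≤s ∣p′∣≤n) p⊥h = begin
        ⟨ p , h ⟩                                     ≈⟨ pairing-extract β p h ⟩
        coeff p β * h β ⊕ ⟨ dropMonomial β p , h ⟩    ≈⟨ +-cong (vanish (p⊥h β)) (go n (dropMonomial β p) shorter rest⊥h) ⟩
        0# ⊕ 0#                                       ≈⟨ +-identityˡ 0# ⟩
        0#                                            ∎
        where
          vanish : ∀ {x y} → x ≈ 0# ⊎ y ≈ 0# → x * y ≈ 0#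
          vanish (inj₁ x≈0) = trans (*-congʳ x≈0) (zeroˡ _)
          vanish (inj₂ y≈0) = trans (*-congˡ y≈0) (zeroʳ _)
          shorter : L.length (dropMonomial β p) ≤ n
          shorter = NP.≤-trans (length-dropMonomial-∷ β b p′) ∣p′∣≤n
          rest⊥h : ∀ α → coeff (dropMonomial β p) α ≈ 0# ⊎ h α ≈ 0#
          rest⊥h α with ≡-dec N._≟_ α β | p⊥h α
          ... | yes Eq.refl | _         = inj₁ (coeff-dropMonomial-≡ α p)
          ... | no α≢β      | inj₁ p≈0  = inj₁ (trans (coeff-dropMonomial-≢ β α p α≢β) p≈0)
          ... | no _        | inj₂ h≈0  = inj₂ h≈0

  record _≈ₚ_ {m} (p r : Poly m) : Set ℓ where
    constructor ⟪_⟫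
    field at : ∀ α → coeff p α ≈ coeff r α
  open _≈ₚ_ public

  ≈ₚ-refl : ∀ {m} {p : Poly m} → p ≈ₚ p
  ≈ₚ-refl = ⟪ (λ α → refl) ⟫

  ≈ₚ-sym : ∀ {m} {p r : Poly m} → p ≈ₚ r → r ≈ₚ p
  ≈ₚ-sym p≈r = ⟪ (λ α → sym (at p≈r α)) ⟫

  ≈ₚ-trans : ∀ {m} {p r s : Poly m} → p ≈ₚ r → r ≈ₚ s → p ≈ₚ s
  ≈ₚ-trans p≈r r≈s = ⟪ (λ α → trans (at p≈r α) (at r≈s α)) ⟫

  ≈ₚ-reflexive : ∀ {m} {p r : Poly m} → p ≡ r → p ≈ₚ r
  ≈ₚ-reflexive Eq.refl = ≈ₚ-refl

  ≈ₚ-setoid : ℕ → Setoid c ℓ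
  ≈ₚ-setoid m = record
    { Carrier = Poly m ; _≈_ = _≈ₚ_
    ; isEquivalence = record { refl = ≈ₚ-refl ; sym = ≈ₚ-sym ; trans = ≈ₚ-trans } }

  module ≈ₚ-Reasoning {m} = SetoidReasoning (≈ₚ-setoid m)

  negₚ : ∀ {m} → Poly m → Poly m
  negₚ = L.map (λ t → (proj₁ t , - proj₂ t))

  coeff-negₚ : ∀ {m} (p : Poly m) α → coeff (negₚ p) α ≈ - coeff p α
  coeff-negₚ [] α = sym -0#≈0#
  coeff-negₚ ((β , b) ∷ p) α = begin
    coeff ((β , - b) ∷ negₚ p) α       ≈⟨ coeff-∷ β (- b) (negₚ p) α ⟩
    kron β α (- b) ⊕ coeff (negₚ p) α  ≈⟨ +-cong (kron-- β α b) (coeff-negₚ p α) ⟩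
    - kron β α b ⊕ - coeff p α         ≈⟨ -‿+-comm _ _ ⟩
    - (kron β α b ⊕ coeff p α)         ≈⟨ -‿cong (coeff-∷ β b p α) ⟨
    - coeff ((β , b) ∷ p) α            ∎
    where open ≈-Reasoning

  pairing-negₚ : ∀ {m} (p : Poly m) h → ⟨ negₚ p , h ⟩ ≈ - ⟨ p , h ⟩
  pairing-negₚ [] h = sym -0#≈0#
  pairing-negₚ ((β , b) ∷ p) h =
    trans (+-cong (sym (-‿distribˡ-* b (h β))) (pairing-negₚ p h)) (-‿+-comm _ _)

  pairing-cong : ∀ {m} {p r : Poly m} h → p ≈ₚ r → ⟨ p , h ⟩ ≈ ⟨ r , h ⟩
  pairing-cong {p = p} {r} h p≈r = x∙y⁻¹≈ε⇒x≈y _ _ (begin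
    ⟨ p , h ⟩ ⊕ - ⟨ r , h ⟩         ≈⟨ +-congˡ (pairing-negₚ r h) ⟨
    ⟨ p , h ⟩ ⊕ ⟨ negₚ r , h ⟩      ≈⟨ ∑-++ p (negₚ r) _ ⟨
    ⟨ p L.++ negₚ r , h ⟩            ≈⟨ pairing-vanishes (p L.++ negₚ r) h (λ α → inj₁ (p-r≈0 α)) ⟩
    0#                               ∎)
    where
      open ≈-Reasoning
      p-r≈0 : ∀ α → coeff (p L.++ negₚ r) α ≈ 0#
      p-r≈0 α = trans (coeff-++ p (negₚ r) α)
        (trans (+-cong (at p≈r α) (coeff-negₚ r α)) (-‿inverseʳ _))

  pairing≈coeff : ∀ {m} (p : Poly m) α → ⟨ p , (λ β → kron β α 1#) ⟩ ≈ coeff p α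
  pairing≈coeff p α = trans (∑-cong p (λ t → kron-*-1# (proj₁ t) α (proj₂ t))) (sym (coeff≈∑ p α))

  -- Products

  _+ᵥ_ : ∀ {m} → Monomial m → Monomial m → Monomial m
  α +ᵥ β = zipWith N._+_ α β

  0ᵥ : ∀ {m} → Monomial m
  0ᵥ = V.replicate _ 0

  +ᵥ-comm : ∀ {m} (α β : Monomial m) → α +ᵥ β ≡ β +ᵥ α
  +ᵥ-comm = VP.zipWith-comm NP.+-comm

  +ᵥ-assoc : ∀ {m} (α β γ : Monomial m) → (α +ᵥ β) +ᵥ γ ≡ α +ᵥ (β +ᵥ γ)
  +ᵥ-assoc = VP.zipWith-assoc NP.+-assoc

  +ᵥ-identityˡ : ∀ {m} (α : Monomial m) → 0ᵥ +ᵥ α ≡ α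
  +ᵥ-identityˡ = VP.zipWith-identityˡ NP.+-identityˡ

  +ᵥ-identityʳ : ∀ {m} (α : Monomial m) → α +ᵥ 0ᵥ ≡ α
  +ᵥ-identityʳ = VP.zipWith-identityʳ NP.+-identityʳ

  ∑-*ₚ : ∀ {m} (p r : Poly m) (F : Monomial m × Carrier → Carrier) →
         ∑ (p *ₚ r) F ≈ ∑ p (λ t → ∑ r (λ u → F (proj₁ t +ᵥ proj₁ u , proj₂ t * proj₂ u)))
  ∑-*ₚ p r F = trans (∑-concatMap p _ F) (∑-cong p (λ t → ∑-map r _ F))

  coeff-*ₚ : ∀ {m} (p r : Poly m) γ →
             coeff (p *ₚ r) γ ≈ ∑ p (λ t → ∑ r (λ u → kron (proj₁ t +ᵥ proj₁ u) γ (proj₂ t * proj₂ u)))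
  coeff-*ₚ p r γ = trans (coeff≈∑ (p *ₚ r) γ) (∑-*ₚ p r _)

  -- the coefficient at γ of p·r is linear in p, with the following weights
  shiftedCoeff : ∀ {m} (r : Poly m) γ → Monomial m → Carrier
  shiftedCoeff r γ β = ∑ r (λ u → kron (β +ᵥ proj₁ u) γ (proj₂ u))

  coeff-*ₚ≈pairing : ∀ {m} (p r : Poly m) γ → coeff (p *ₚ r) γ ≈ ⟨ p , shiftedCoeff r γ ⟩
  coeff-*ₚ≈pairing p r γ = trans (coeff-*ₚ p r γ) (∑-cong p (λ t →
    trans (∑-cong r (λ u → kron-* (proj₁ t +ᵥ proj₁ u) γ (proj₂ t) (proj₂ u)))
          (sym (*-distribˡ-∑ r (proj₂ t) _))))

  *ₚ-comm : ∀ {m} (p r : Poly m) → (p *ₚ r) ≈ₚ (r *ₚ p)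
  *ₚ-comm p r = ⟪ (λ γ → begin
    coeff (p *ₚ r) γ  ≈⟨ coeff-*ₚ p r γ ⟩
    ∑ p (λ t → ∑ r _) ≈⟨ ∑-comm p r _ ⟩
    ∑ r (λ u → ∑ p _) ≈⟨ ∑-cong r (λ u → ∑-cong p (λ t →
                           kron-cong (+ᵥ-comm (proj₁ t) (proj₁ u)) (*-comm _ _))) ⟩
    ∑ r (λ u → ∑ p _) ≈⟨ coeff-*ₚ r p γ ⟨
    coeff (r *ₚ p) γ  ∎) ⟫
    where open ≈-Reasoning

  *ₚ-assoc : ∀ {m} (p r s : Poly m) → ((p *ₚ r) *ₚ s) ≈ₚ (p *ₚ (r *ₚ s))
  *ₚ-assoc p r s = ⟪ (λ γ → begin
    coeff ((p *ₚ r) *ₚ s) γ                      ≈⟨ coeff≈∑ ((p *ₚ r) *ₚ s) γ ⟩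
    ∑ ((p *ₚ r) *ₚ s) _                          ≈⟨ trans (∑-*ₚ (p *ₚ r) s _) (∑-*ₚ p r _) ⟩
    ∑ p (λ t → ∑ r (λ u → ∑ s _))                ≈⟨ ∑-cong p (λ t → ∑-cong r (λ u → ∑-cong s (λ w →
                                                      kron-cong (+ᵥ-assoc (proj₁ t) (proj₁ u) (proj₁ w)) (*-assoc _ _ _)))) ⟩
    ∑ p (λ t → ∑ r (λ u → ∑ s _))                ≈⟨ ∑-cong p (λ t → ∑-*ₚ r s _) ⟨
    ∑ p (λ t → ∑ (r *ₚ s) _)                     ≈⟨ ∑-*ₚ p (r *ₚ s) _ ⟨
    ∑ (p *ₚ (r *ₚ s)) _                          ≈⟨ coeff≈∑ (p *ₚ (r *ₚ s)) γ ⟨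
    coeff (p *ₚ (r *ₚ s)) γ                      ∎) ⟫
    where open ≈-Reasoning

  *ₚ-distribʳ : ∀ {m} (p r s : Poly m) → ((p +ₚ r) *ₚ s) ≈ₚ ((p *ₚ s) +ₚ (r *ₚ s))
  *ₚ-distribʳ p r s = ⟪ (λ γ → begin
    coeff ((p +ₚ r) *ₚ s) γ                 ≈⟨ coeff-*ₚ (p +ₚ r) s γ ⟩
    ∑ (p +ₚ r) _                            ≈⟨ ∑-++ p r _ ⟩
    ∑ p _ ⊕ ∑ r _                           ≈⟨ +-cong (coeff-*ₚ p s γ) (coeff-*ₚ r s γ) ⟨
    coeff (p *ₚ s) γ ⊕ coeff (r *ₚ s) γ     ≈⟨ coeff-++ (p *ₚ s) (r *ₚ s) γ ⟨
    coeff ((p *ₚ s) +ₚ (r *ₚ s)) γ          ∎) ⟫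
    where open ≈-Reasoning

  *ₚ-congʳ : ∀ {m} {p p′ : Poly m} (r : Poly m) → p ≈ₚ p′ → (p *ₚ r) ≈ₚ (p′ *ₚ r)
  *ₚ-congʳ {p = p} {p′} r p≈p′ = ⟪ (λ γ → begin
    coeff (p *ₚ r) γ            ≈⟨ coeff-*ₚ≈pairing p r γ ⟩
    ⟨ p , shiftedCoeff r γ ⟩    ≈⟨ pairing-cong (shiftedCoeff r γ) p≈p′ ⟩
    ⟨ p′ , shiftedCoeff r γ ⟩   ≈⟨ coeff-*ₚ≈pairing p′ r γ ⟨
    coeff (p′ *ₚ r) γ           ∎) ⟫
    where open ≈-Reasoning

  *ₚ-cong : ∀ {m} {p p′ r r′ : Poly m} → p ≈ₚ p′ → r ≈ₚ r′ → (p *ₚ r) ≈ₚ (p′ *ₚ r′)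
  *ₚ-cong {p = p} {p′} {r} {r′} p≈p′ r≈r′ = begin
    p *ₚ r   ≈⟨ *ₚ-congʳ r p≈p′ ⟩
    p′ *ₚ r  ≈⟨ *ₚ-comm p′ r ⟩
    r *ₚ p′  ≈⟨ *ₚ-congʳ p′ r≈r′ ⟩
    r′ *ₚ p′ ≈⟨ *ₚ-comm r′ p′ ⟩
    p′ *ₚ r′ ∎
    where open ≈ₚ-Reasoning

  *ₚ-congˡ : ∀ {m} (p : Poly m) {r r′ : Poly m} → r ≈ₚ r′ → (p *ₚ r) ≈ₚ (p *ₚ r′)
  *ₚ-congˡ p = *ₚ-cong (≈ₚ-refl {p = p})

  +ₚ-cong : ∀ {m} {p p′ r r′ : Poly m} → p ≈ₚ p′ → r ≈ₚ r′ → (p +ₚ r) ≈ₚ (p′ +ₚ r′)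
  +ₚ-cong {p = p} {p′} {r} {r′} p≈p′ r≈r′ = ⟪ (λ γ →
    trans (coeff-++ p r γ) (trans (+-cong (at p≈p′ γ) (at r≈r′ γ)) (sym (coeff-++ p′ r′ γ)))) ⟫

  *ₚ-interchange : ∀ {m} (a b x y : Poly m) → ((a *ₚ b) *ₚ (x *ₚ y)) ≈ₚ ((a *ₚ x) *ₚ (b *ₚ y))
  *ₚ-interchange a b x y = begin
    (a *ₚ b) *ₚ (x *ₚ y) ≈⟨ *ₚ-assoc a b (x *ₚ y) ⟩
    a *ₚ (b *ₚ (x *ₚ y)) ≈⟨ *ₚ-congˡ a (≈ₚ-sym (*ₚ-assoc b x y)) ⟩
    a *ₚ ((b *ₚ x) *ₚ y) ≈⟨ *ₚ-congˡ a (*ₚ-congʳ y (*ₚ-comm b x)) ⟩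
    a *ₚ ((x *ₚ b) *ₚ y) ≈⟨ *ₚ-congˡ a (*ₚ-assoc x b y) ⟩
    a *ₚ (x *ₚ (b *ₚ y)) ≈⟨ *ₚ-assoc a x (b *ₚ y) ⟨
    (a *ₚ x) *ₚ (b *ₚ y) ∎
    where open ≈ₚ-Reasoning

  *ₚ-zeroʳ : ∀ {m} (p : Poly m) → (p *ₚ []) ≈ₚ []
  *ₚ-zeroʳ p = ⟪ (λ γ → trans (coeff-*ₚ p [] γ) (∑-zero p (λ _ → refl))) ⟫

  ^ₚ-cong : ∀ {m} {p p′ : Poly m} → p ≈ₚ p′ → ∀ k → (p ^ₚ k) ≈ₚ (p′ ^ₚ k)
  ^ₚ-cong p≈p′ N.zero    = ≈ₚ-refl
  ^ₚ-cong p≈p′ (N.suc k) = *ₚ-cong p≈p′ (^ₚ-cong p≈p′ k)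

  coeff-const : ∀ {m} a (γ : Monomial m) → coeff (const a) γ ≈ kron 0ᵥ γ a
  coeff-const a γ = coeff-singleton 0ᵥ a γ

  const-*ₚ : ∀ {m} a (p : Poly m) γ → coeff (const a *ₚ p) γ ≈ a * coeff p γ
  const-*ₚ a p γ = begin
    coeff (const a *ₚ p) γ                            ≈⟨ trans (coeff-*ₚ (const a) p γ) (+-identityʳ _) ⟩
    ∑ p (λ u → kron (0ᵥ +ᵥ proj₁ u) γ (a * proj₂ u))  ≈⟨ ∑-cong p (λ u → trans (kron-cong (+ᵥ-identityˡ (proj₁ u)) refl)
                                                                             (kron-* (proj₁ u) γ a (proj₂ u))) ⟩
    ∑ p (λ u → a * kron (proj₁ u) γ (proj₂ u))        ≈⟨ *-distribˡ-∑ p a _ ⟨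
    a * ∑ p _                                         ≈⟨ *-congˡ (coeff≈∑ p γ) ⟨
    a * coeff p γ                                     ∎
    where open ≈-Reasoning

  const-1#-*ₚ : ∀ {m} (p : Poly m) → (const 1# *ₚ p) ≈ₚ p
  const-1#-*ₚ p = ⟪ (λ γ → trans (const-*ₚ 1# p γ) (*-identityˡ _)) ⟫

  const-*ₚ-const : ∀ {m} a b → (const {m} a *ₚ const b) ≈ₚ const (a * b)
  const-*ₚ-const a b = ⟪ (λ γ → begin
    coeff (const a *ₚ const b) γ ≈⟨ const-*ₚ a (const b) γ ⟩
    a * coeff (const b) γ        ≈⟨ *-congˡ (coeff-const b γ) ⟩
    a * kron 0ᵥ γ b              ≈⟨ kron-* 0ᵥ γ a b ⟨
    kron 0ᵥ γ (a * b)            ≈⟨ coeff-const (a * b) γ ⟨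
    coeff (const (a * b)) γ      ∎) ⟫
    where open ≈-Reasoning

  const-+ₚ-const : ∀ {m} a b → (const {m} a +ₚ const b) ≈ₚ const (a ⊕ b)
  const-+ₚ-const a b = ⟪ (λ γ → begin
    coeff (const a +ₚ const b) γ           ≈⟨ coeff-++ (const a) (const b) γ ⟩
    coeff (const a) γ ⊕ coeff (const b) γ  ≈⟨ +-cong (coeff-const a γ) (coeff-const b γ) ⟩
    kron 0ᵥ γ a ⊕ kron 0ᵥ γ b              ≈⟨ kron-⊕ 0ᵥ γ a b ⟨
    kron 0ᵥ γ (a ⊕ b)                      ≈⟨ coeff-const (a ⊕ b) γ ⟨
    coeff (const (a ⊕ b)) γ                ∎) ⟫
    where open ≈-Reasoning

  const-cong : ∀ {m} {a b} → a ≈ b → const {m} a ≈ₚ const b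
  const-cong a≈b = ⟪ (λ γ → trans (coeff-const _ γ)
    (trans (kron-cong {β = 0ᵥ} {α = γ} Eq.refl a≈b) (sym (coeff-const _ γ)))) ⟫

  const-0# : ∀ {m} → const {m} 0# ≈ₚ []
  const-0# = ⟪ (λ γ → trans (coeff-const 0# γ) (kron-0# 0ᵥ γ)) ⟫

  -- Substitution

  powₚ : ∀ {m k} → Vec (Poly k) m → Monomial m → Poly k
  powₚ σ α = V.foldr _ _*ₚ_ (const 1#) (zipWith _^ₚ_ σ α)

  _≈ᵥ_ : ∀ {m k} → Vec (Poly k) m → Vec (Poly k) m → Set ℓ
  σ ≈ᵥ τ = ∀ i → lookup σ i ≈ₚ lookup τ i

  ^ₚ-+ : ∀ {m} (p : Poly m) i j → (p ^ₚ (i + j)) ≈ₚ ((p ^ₚ i) *ₚ (p ^ₚ j))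
  ^ₚ-+ p N.zero    j = ≈ₚ-sym (const-1#-*ₚ (p ^ₚ j))
  ^ₚ-+ p (N.suc i) j = ≈ₚ-trans (*ₚ-congˡ p (^ₚ-+ p i j)) (≈ₚ-sym (*ₚ-assoc p (p ^ₚ i) (p ^ₚ j)))

  powₚ-+ᵥ : ∀ {m k} (σ : Vec (Poly k) m) α β → powₚ σ (α +ᵥ β) ≈ₚ (powₚ σ α *ₚ powₚ σ β)
  powₚ-+ᵥ V.[]       V.[]       V.[]       = ≈ₚ-sym (const-1#-*ₚ (const 1#))
  powₚ-+ᵥ (s V.∷ σ) (i V.∷ α) (j V.∷ β) =
    ≈ₚ-trans (*ₚ-cong (^ₚ-+ s i j) (powₚ-+ᵥ σ α β)) (*ₚ-interchange (s ^ₚ i) (s ^ₚ j) (powₚ σ α) (powₚ σ β))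

  powₚ-0ᵥ : ∀ {m k} (σ : Vec (Poly k) m) → powₚ σ 0ᵥ ≈ₚ const 1#
  powₚ-0ᵥ V.[]       = ≈ₚ-refl
  powₚ-0ᵥ (s V.∷ σ) = ≈ₚ-trans (const-1#-*ₚ (powₚ σ 0ᵥ)) (powₚ-0ᵥ σ)

  powₚ-cong : ∀ {m k} {σ τ : Vec (Poly k) m} → σ ≈ᵥ τ → ∀ α → powₚ σ α ≈ₚ powₚ τ α
  powₚ-cong {σ = V.[]}     {V.[]}     σ≈τ V.[]       = ≈ₚ-refl
  powₚ-cong {σ = s V.∷ σ} {t V.∷ τ} σ≈τ (i V.∷ α) =
    *ₚ-cong (^ₚ-cong (σ≈τ Fn.zero) i) (powₚ-cong {σ = σ} {τ} (λ j → σ≈τ (Fn.suc j)) α)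

  powₚ-++ : ∀ {k j j′} (u : Vec (Poly k) j) (v : Vec (Poly k) j′) x y →
            powₚ (u ++ v) (x ++ y) ≈ₚ (powₚ u x *ₚ powₚ v y)
  powₚ-++ V.[]       v V.[]       y = ≈ₚ-sym (const-1#-*ₚ (powₚ v y))
  powₚ-++ (s V.∷ u) v (i V.∷ x) y =
    ≈ₚ-trans (*ₚ-congˡ (s ^ₚ i) (powₚ-++ u v x y)) (≈ₚ-sym (*ₚ-assoc (s ^ₚ i) (powₚ u x) (powₚ v y)))

  substTerm : ∀ {m k} → Vec (Poly k) m → Monomial m × Carrier → Poly k
  substTerm σ t = const (proj₂ t) *ₚ powₚ σ (proj₁ t)

  coeff-subst : ∀ {m k} (p : Poly m) (σ : Vec (Poly k) m) γ →
                coeff (subst p σ) γ ≈ ⟨ p , (λ β → coeff (powₚ σ β) γ) ⟩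
  coeff-subst p σ γ = trans (coeff-concatMap p (substTerm σ) γ)
    (∑-cong p (λ t → const-*ₚ (proj₂ t) (powₚ σ (proj₁ t)) γ))

  subst-cong : ∀ {m k} {p p′ : Poly m} (σ : Vec (Poly k) m) → p ≈ₚ p′ → subst p σ ≈ₚ subst p′ σ
  subst-cong {p = p} {p′} σ p≈p′ = ⟪ (λ γ → trans (coeff-subst p σ γ)
    (trans (pairing-cong _ p≈p′) (sym (coeff-subst p′ σ γ)))) ⟫

  subst-congʳ : ∀ {m k} (p : Poly m) {σ τ : Vec (Poly k) m} → σ ≈ᵥ τ → subst p σ ≈ₚ subst p τ
  subst-congʳ p {σ} {τ} σ≈τ = ⟪ (λ γ → trans (coeff-subst p σ γ)
    (trans (∑-cong p (λ t → *-congˡ (at (powₚ-cong {σ = σ} {τ} σ≈τ (proj₁ t)) γ)))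
           (sym (coeff-subst p τ γ)))) ⟫

  subst-+ₚ : ∀ {m k} (p r : Poly m) (σ : Vec (Poly k) m) → subst (p +ₚ r) σ ≈ₚ (subst p σ +ₚ subst r σ)
  subst-+ₚ p r σ = ≈ₚ-reflexive (LP.concatMap-++ (substTerm σ) p r)

  coeff-concatMap-*ₚ : ∀ {a m} {A : Set a} (g : A → Poly m) (xs : List A) (B : Poly m) γ →
                       coeff (L.concatMap g xs *ₚ B) γ ≈ ∑ xs (λ t → coeff (g t *ₚ B) γ)
  coeff-concatMap-*ₚ g xs B γ = trans (coeff-*ₚ (L.concatMap g xs) B γ)
    (trans (∑-concatMap xs g _) (∑-cong xs (λ t → sym (coeff-*ₚ (g t) B γ))))

  coeff-*ₚ-concatMap : ∀ {a m} {A : Set a} (g : A → Poly m) (xs : List A) (B : Poly m) γ →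
                       coeff (B *ₚ L.concatMap g xs) γ ≈ ∑ xs (λ t → coeff (B *ₚ g t) γ)
  coeff-*ₚ-concatMap g xs B γ = trans (at (*ₚ-comm B (L.concatMap g xs)) γ)
    (trans (coeff-concatMap-*ₚ g xs B γ) (∑-cong xs (λ t → at (*ₚ-comm (g t) B) γ)))

  substTerm-*ₚ : ∀ {m k} (σ : Vec (Poly k) m) t u →
    (substTerm σ t *ₚ substTerm σ u) ≈ₚ (const (proj₂ t * proj₂ u) *ₚ powₚ σ (proj₁ t +ᵥ proj₁ u))
  substTerm-*ₚ σ (α , a) (β , b) = ≈ₚ-trans (*ₚ-interchange (const a) (powₚ σ α) (const b) (powₚ σ β))
    (*ₚ-cong (const-*ₚ-const a b) (≈ₚ-sym (powₚ-+ᵥ σ α β)))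

  subst-*ₚ : ∀ {m k} (p r : Poly m) (σ : Vec (Poly k) m) → subst (p *ₚ r) σ ≈ₚ (subst p σ *ₚ subst r σ)
  subst-*ₚ p r σ = ⟪ (λ γ → begin
    coeff (subst (p *ₚ r) σ) γ                       ≈⟨ coeff-concatMap (p *ₚ r) (substTerm σ) γ ⟩
    ∑ (p *ₚ r) (λ t → coeff (substTerm σ t) γ)       ≈⟨ ∑-*ₚ p r _ ⟩
    ∑ p (λ t → ∑ r (λ u → coeff (substTerm σ _) γ))  ≈⟨ ∑-cong p (λ t → ∑-cong r (λ u → at (substTerm-*ₚ σ t u) γ)) ⟨
    ∑ p (λ t → ∑ r (λ u → coeff (substTerm σ t *ₚ substTerm σ u) γ))
        ≈⟨ ∑-cong p (λ t → coeff-*ₚ-concatMap (substTerm σ) r (substTerm σ t) γ) ⟨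
    ∑ p (λ t → coeff (substTerm σ t *ₚ subst r σ) γ) ≈⟨ coeff-concatMap-*ₚ (substTerm σ) p (subst r σ) γ ⟨
    coeff (subst p σ *ₚ subst r σ) γ                 ∎) ⟫
    where open ≈-Reasoning

  subst-const : ∀ {m k} a (σ : Vec (Poly k) m) → subst (const a) σ ≈ₚ const a
  subst-const a σ = begin
    subst (const a) σ            ≈⟨ ≈ₚ-reflexive (LP.++-identityʳ _) ⟩
    const a *ₚ powₚ σ 0ᵥ         ≈⟨ *ₚ-congˡ (const a) (powₚ-0ᵥ σ) ⟩
    const a *ₚ const 1#          ≈⟨ const-*ₚ-const a 1# ⟩
    const (a * 1#)               ≈⟨ const-cong (*-identityʳ a) ⟩
    const a                      ∎
    where open ≈ₚ-Reasoning

  subst-^ₚ : ∀ {m k} (p : Poly m) (σ : Vec (Poly k) m) n → subst (p ^ₚ n) σ ≈ₚ (subst p σ ^ₚ n)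
  subst-^ₚ p σ N.zero    = subst-const 1# σ
  subst-^ₚ p σ (N.suc n) = ≈ₚ-trans (subst-*ₚ p (p ^ₚ n) σ) (*ₚ-congˡ (subst p σ) (subst-^ₚ p σ n))

  subst-powₚ : ∀ {m k j} (τ : Vec (Poly k) m) (σ : Vec (Poly j) k) α →
               subst (powₚ τ α) σ ≈ₚ powₚ (map (λ s → subst s σ) τ) α
  subst-powₚ V.[]       σ V.[]       = subst-const 1# σ
  subst-powₚ (t V.∷ τ) σ (i V.∷ α) =
    ≈ₚ-trans (subst-*ₚ (t ^ₚ i) (powₚ τ α) σ) (*ₚ-cong (subst-^ₚ t σ i) (subst-powₚ τ σ α))

  subst-subst : ∀ {m k j} (p : Poly m) (τ : Vec (Poly k) m) (σ : Vec (Poly j) k) →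
                subst (subst p τ) σ ≈ₚ subst p (map (λ s → subst s σ) τ)
  subst-subst p τ σ = ⟪ (λ γ → begin
    coeff (subst (subst p τ) σ) γ                     ≈⟨ coeff-concatMap (subst p τ) (substTerm σ) γ ⟩
    ∑ (subst p τ) (λ u → coeff (substTerm σ u) γ)     ≈⟨ ∑-concatMap p (substTerm τ) _ ⟩
    ∑ p (λ t → ∑ (substTerm τ t) _)                   ≈⟨ ∑-cong p (λ t → coeff-concatMap (substTerm τ t) (substTerm σ) γ) ⟨
    ∑ p (λ t → coeff (subst (substTerm τ t) σ) γ)     ≈⟨ ∑-cong p (λ t → at (term t) γ) ⟩
    ∑ p (λ t → coeff (substTerm τσ t) γ)              ≈⟨ coeff-concatMap p (substTerm τσ) γ ⟨
    coeff (subst p τσ) γ                              ∎) ⟫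
    where
      open ≈-Reasoning
      τσ = map (λ s → subst s σ) τ
      term : ∀ t → subst (substTerm τ t) σ ≈ₚ substTerm τσ t
      term (α , a) = ≈ₚ-trans (subst-*ₚ (const a) (powₚ τ α) σ)
                              (*ₚ-cong (subst-const a σ) (subst-powₚ τ σ α))

  -- Evaluation

  pow : ∀ {m} → Vec Carrier m → Monomial m → Carrier
  pow x α = V.foldr _ _*_ 1# (zipWith _^ᴿ_ x α)

  ^ᴿ-+ : ∀ x i j → x ^ᴿ (i + j) ≈ (x ^ᴿ i) * (x ^ᴿ j)
  ^ᴿ-+ x N.zero    j = sym (*-identityˡ _)
  ^ᴿ-+ x (N.suc i) j = trans (*-congˡ (^ᴿ-+ x i j)) (sym (*-assoc _ _ _))

  ^ᴿ-cong : ∀ {x y} → x ≈ y → ∀ n → x ^ᴿ n ≈ y ^ᴿ n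
  ^ᴿ-cong x≈y N.zero    = refl
  ^ᴿ-cong x≈y (N.suc n) = *-cong x≈y (^ᴿ-cong x≈y n)

  pow-+ᵥ : ∀ {m} (x : Vec Carrier m) α β → pow x (α +ᵥ β) ≈ pow x α * pow x β
  pow-+ᵥ V.[]        V.[]       V.[]       = sym (*-identityˡ 1#)
  pow-+ᵥ (x V.∷ xs) (i V.∷ α) (j V.∷ β) = trans (*-cong (^ᴿ-+ x i j) (pow-+ᵥ xs α β)) (*-interchange _ _ _ _)

  pow-0ᵥ : ∀ {m} (x : Vec Carrier m) → pow x 0ᵥ ≈ 1#
  pow-0ᵥ V.[]        = refl
  pow-0ᵥ (x V.∷ xs) = trans (*-identityˡ _) (pow-0ᵥ xs)

  pow-cong : ∀ {m} {x y : Vec Carrier m} → (∀ i → lookup x i ≈ lookup y i) → ∀ β → pow x β ≈ pow y β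
  pow-cong {x = V.[]}      {V.[]}      x≈y V.[]       = refl
  pow-cong {x = x V.∷ xs} {y V.∷ ys} x≈y (i V.∷ β) =
    *-cong (^ᴿ-cong (x≈y Fn.zero) i) (pow-cong {x = xs} {ys} (λ j → x≈y (Fn.suc j)) β)

  eval-cong : ∀ {m} {p p′ : Poly m} x → p ≈ₚ p′ → eval p x ≈ eval p′ x
  eval-cong x = pairing-cong (pow x)

  eval-congʳ : ∀ {m} (p : Poly m) {x y : Vec Carrier m} → (∀ i → lookup x i ≈ lookup y i) → eval p x ≈ eval p y
  eval-congʳ p {x} {y} x≈y = ∑-cong p (λ t → *-congˡ (pow-cong {x = x} {y} x≈y (proj₁ t)))

  eval-+ₚ : ∀ {m} (p r : Poly m) x → eval (p +ₚ r) x ≈ eval p x ⊕ eval r x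
  eval-+ₚ p r x = ∑-++ p r _

  eval-*ₚ : ∀ {m} (p r : Poly m) x → eval (p *ₚ r) x ≈ eval p x * eval r x
  eval-*ₚ p r x = begin
    eval (p *ₚ r) x                                                    ≈⟨ ∑-*ₚ p r _ ⟩
    ∑ p (λ t → ∑ r (λ u → (proj₂ t * proj₂ u) * pow x (proj₁ t +ᵥ proj₁ u)))
        ≈⟨ ∑-cong p (λ t → ∑-cong r (λ u → trans (*-congˡ (pow-+ᵥ x (proj₁ t) (proj₁ u))) (*-interchange _ _ _ _))) ⟩
    ∑ p (λ t → ∑ r (λ u → (proj₂ t * pow x (proj₁ t)) * (proj₂ u * pow x (proj₁ u))))
        ≈⟨ ∑-cong p (λ t → *-distribˡ-∑ r _ _) ⟨
    ∑ p (λ t → (proj₂ t * pow x (proj₁ t)) * eval r x)                ≈⟨ *-distribʳ-∑ p _ _ ⟨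
    eval p x * eval r x                                                ∎
    where open ≈-Reasoning

  eval-const : ∀ {m} a (x : Vec Carrier m) → eval (const a) x ≈ a
  eval-const a x = trans (+-identityʳ _) (trans (*-congˡ (pow-0ᵥ x)) (*-identityʳ a))

  eval-^ₚ : ∀ {m} (p : Poly m) x n → eval (p ^ₚ n) x ≈ (eval p x) ^ᴿ n
  eval-^ₚ p x N.zero    = eval-const 1# x
  eval-^ₚ p x (N.suc n) = trans (eval-*ₚ p (p ^ₚ n) x) (*-congˡ (eval-^ₚ p x n))

  eval-powₚ : ∀ {m k} (τ : Vec (Poly k) m) α x → eval (powₚ τ α) x ≈ pow (map (λ s → eval s x) τ) α
  eval-powₚ V.[]       V.[]       x = eval-const 1# x
  eval-powₚ (t V.∷ τ) (i V.∷ α) x =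
    trans (eval-*ₚ (t ^ₚ i) (powₚ τ α) x) (*-cong (eval-^ₚ t x i) (eval-powₚ τ α x))

  eval-subst : ∀ {m k} (p : Poly m) (τ : Vec (Poly k) m) x →
               eval (subst p τ) x ≈ eval p (map (λ s → eval s x) τ)
  eval-subst p τ x = trans (∑-concatMap p (substTerm τ) _) (∑-cong p (λ t →
    trans (eval-*ₚ (const (proj₂ t)) (powₚ τ (proj₁ t)) x)
          (*-cong (eval-const (proj₂ t) x) (eval-powₚ τ (proj₁ t) x))))

  -- Monomials and variables

  mono : ∀ {m} → Monomial m → Poly m
  mono β = (β , 1#) ∷ []

  coeff-mono : ∀ {m} (β γ : Monomial m) → coeff (mono β) γ ≈ kron β γ 1#
  coeff-mono β γ = coeff-singleton β 1# γ

  mono-*ₚ : ∀ {m} (α β : Monomial m) → (mono α *ₚ mono β) ≈ₚ mono (α +ᵥ β)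
  mono-*ₚ α β = ⟪ (λ γ → begin
    coeff (mono α *ₚ mono β) γ   ≈⟨ trans (coeff-*ₚ (mono α) (mono β) γ) (trans (+-identityʳ _) (+-identityʳ _)) ⟩
    kron (α +ᵥ β) γ (1# * 1#)   ≈⟨ kron-cong {β = α +ᵥ β} {α = γ} Eq.refl (*-identityˡ 1#) ⟩
    kron (α +ᵥ β) γ 1#          ≈⟨ coeff-mono (α +ᵥ β) γ ⟨
    coeff (mono (α +ᵥ β)) γ      ∎) ⟫
    where open ≈-Reasoning

  _·ᵥ_ : ∀ {m} → ℕ → Monomial m → Monomial m
  k ·ᵥ α = map (k N.*_) α

  mono-^ₚ : ∀ {m} (α : Monomial m) k → (mono α ^ₚ k) ≈ₚ mono (k ·ᵥ α)
  mono-^ₚ α N.zero    = ≈ₚ-reflexive (Eq.cong mono (Eq.sym (0·ᵥ α)))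
    where
      0·ᵥ : ∀ {m} (α : Monomial m) → 0 ·ᵥ α ≡ 0ᵥ
      0·ᵥ V.[]       = Eq.refl
      0·ᵥ (i V.∷ α) = Eq.cong (0 V.∷_) (0·ᵥ α)
  mono-^ₚ α (N.suc k) = ≈ₚ-trans (*ₚ-congˡ (mono α) (mono-^ₚ α k))
    (≈ₚ-trans (mono-*ₚ α (k ·ᵥ α)) (≈ₚ-reflexive (Eq.cong mono (Eq.sym (suc·ᵥ α)))))
    where
      suc·ᵥ : ∀ {m} (α : Monomial m) → N.suc k ·ᵥ α ≡ α +ᵥ (k ·ᵥ α)
      suc·ᵥ V.[]       = Eq.refl
      suc·ᵥ (i V.∷ α) = Eq.cong (_ V.∷_) (suc·ᵥ α)

  combine : ∀ {m k} → Vec (Monomial k) m → Monomial m → Monomial k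
  combine V.[]       V.[]       = 0ᵥ
  combine (e V.∷ E) (b V.∷ β) = (b ·ᵥ e) +ᵥ combine E β

  powₚ-mono : ∀ {m k} (E : Vec (Monomial k) m) β → powₚ (map mono E) β ≈ₚ mono (combine E β)
  powₚ-mono V.[]       V.[]       = ≈ₚ-refl
  powₚ-mono (e V.∷ E) (b V.∷ β) =
    ≈ₚ-trans (*ₚ-cong (mono-^ₚ e b) (powₚ-mono E β)) (mono-*ₚ (b ·ᵥ e) (combine E β))

  eᵥ : ∀ {m} → Fin m → Monomial m
  eᵥ Fn.zero    = 1 V.∷ 0ᵥ
  eᵥ (Fn.suc i) = 0 V.∷ eᵥ i

  ∣0ᵥ∣ : ∀ {m} → ∣ 0ᵥ {m} ∣ₘ ≡ 0
  ∣0ᵥ∣ {N.zero}  = Eq.refl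
  ∣0ᵥ∣ {N.suc m} = ∣0ᵥ∣ {m}

  ∣eᵥ∣ : ∀ {m} (i : Fin m) → ∣ eᵥ i ∣ₘ ≡ 1
  ∣eᵥ∣ {N.suc m} Fn.zero = Eq.cong N.suc (∣0ᵥ∣ {m})
  ∣eᵥ∣ (Fn.suc i) = ∣eᵥ∣ i

  combine-eᵥ : ∀ {m} (β : Monomial m) → combine (tabulate eᵥ) β ≡ β
  combine-eᵥ V.[] = Eq.refl
  combine-eᵥ {N.suc m} (b V.∷ β) = begin
    combine (tabulate eᵥ) (b V.∷ β)
      ≡⟨ Eq.cong (λ E → (b ·ᵥ eᵥ Fn.zero) +ᵥ combine E β) (VP.tabulate-∘ (0 V.∷_) eᵥ) ⟩
    (b ·ᵥ eᵥ Fn.zero) +ᵥ combine (map (0 V.∷_) (tabulate eᵥ)) β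
      ≡⟨ Eq.cong ((b ·ᵥ eᵥ Fn.zero) +ᵥ_) (combine-0∷ (tabulate eᵥ) β) ⟩
    (b ·ᵥ eᵥ Fn.zero) +ᵥ (0 V.∷ combine (tabulate eᵥ) β)
      ≡⟨ Eq.cong₂ V._∷_ (Eq.trans (NP.+-identityʳ _) (NP.*-identityʳ b))
                        (Eq.trans (Eq.cong (_+ᵥ _) (·ᵥ-0ᵥ b)) (Eq.trans (+ᵥ-identityˡ _) (combine-eᵥ β))) ⟩
    b V.∷ β
      ∎
    where
      open Eq.≡-Reasoning
      ·ᵥ-0ᵥ : ∀ {m} k → k ·ᵥ 0ᵥ {m} ≡ 0ᵥ
      ·ᵥ-0ᵥ {N.zero}  k = Eq.refl
      ·ᵥ-0ᵥ {N.suc m} k = Eq.cong₂ V._∷_ (NP.*-zeroʳ k) (·ᵥ-0ᵥ k)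
      combine-0∷ : ∀ {m k} (E : Vec (Monomial k) m) β → combine (map (0 V.∷_) E) β ≡ 0 V.∷ combine E β
      combine-0∷ V.[]       V.[]       = Eq.refl
      combine-0∷ (e V.∷ E) (b V.∷ β) =
        Eq.cong₂ (λ x v → (x V.∷ (b ·ᵥ e)) +ᵥ v) (NP.*-zeroʳ b) (combine-0∷ E β)

  -- var is defined through a helper local to Defs; unification recovers its exponent vector
  var-exponent : ∀ {m} (i : Fin m) → ∃ λ (u : Fin m → ℕ) → var i ≡ (tabulate u , 1#) ∷ []
  var-exponent i = _ , Eq.refl

  var-≡ : ∀ {m} (i : Fin m) → var i ≡ mono (eᵥ i)
  var-≡ i = Eq.trans (proj₂ (var-exponent i))
    (Eq.cong mono (Eq.trans (VP.tabulate-cong (entry i)) (VP.tabulate∘lookup (eᵥ i))))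
    where
      lookup-eᵥ-≡ : ∀ {m} (i : Fin m) → lookup (eᵥ i) i ≡ 1
      lookup-eᵥ-≡ Fn.zero    = Eq.refl
      lookup-eᵥ-≡ (Fn.suc i) = lookup-eᵥ-≡ i
      lookup-eᵥ-≢ : ∀ {m} (i j : Fin m) → ¬ i ≡ j → lookup (eᵥ i) j ≡ 0
      lookup-eᵥ-≢ Fn.zero    Fn.zero    i≢j = ⊥-elim (i≢j Eq.refl)
      lookup-eᵥ-≢ Fn.zero    (Fn.suc j) _   = VP.lookup-replicate j 0
      lookup-eᵥ-≢ (Fn.suc i) Fn.zero    _   = Eq.refl
      lookup-eᵥ-≢ (Fn.suc i) (Fn.suc j) i≢j = lookup-eᵥ-≢ i j (λ i≡j → i≢j (Eq.cong Fn.suc i≡j))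
      entry : ∀ i j → proj₁ (var-exponent i) j ≡ lookup (eᵥ i) j
      entry i j with i Fn.≟ j
      ... | yes Eq.refl = Eq.sym (lookup-eᵥ-≡ i)
      ... | no i≢j      = Eq.sym (lookup-eᵥ-≢ i j i≢j)

  var-≈ : ∀ {m} (i : Fin m) → var i ≈ₚ mono (eᵥ i)
  var-≈ i = ≈ₚ-reflexive (var-≡ i)

  coeff-var : ∀ {m} (i : Fin m) γ → coeff (var i) γ ≈ kron (eᵥ i) γ 1#
  coeff-var i γ = trans (at (var-≈ i) γ) (coeff-mono (eᵥ i) γ)

  powₚ-vars : ∀ {m} (β : Monomial m) → powₚ (tabulate (var {m})) β ≈ₚ mono β
  powₚ-vars β = begin
    powₚ (tabulate var) β            ≡⟨ Eq.cong (λ σ → powₚ σ β) vars≡ ⟩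
    powₚ (map mono (tabulate eᵥ)) β  ≈⟨ powₚ-mono (tabulate eᵥ) β ⟩
    mono (combine (tabulate eᵥ) β)   ≡⟨ Eq.cong mono (combine-eᵥ β) ⟩
    mono β                           ∎
    where
      open ≈ₚ-Reasoning
      vars≡ = Eq.trans (VP.tabulate-cong var-≡) (VP.tabulate-∘ mono eᵥ)

  powₚ-eᵥ : ∀ {m k} (σ : Vec (Poly k) m) i → powₚ σ (eᵥ i) ≈ₚ lookup σ i
  powₚ-eᵥ (s V.∷ σ) Fn.zero = begin
    (s *ₚ const 1#) *ₚ powₚ σ 0ᵥ  ≈⟨ *ₚ-cong (*ₚ-comm s (const 1#)) (powₚ-0ᵥ σ) ⟩
    (const 1# *ₚ s) *ₚ const 1#   ≈⟨ *ₚ-comm (const 1# *ₚ s) (const 1#) ⟩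
    const 1# *ₚ (const 1# *ₚ s)   ≈⟨ const-1#-*ₚ _ ⟩
    const 1# *ₚ s                 ≈⟨ const-1#-*ₚ s ⟩
    s                             ∎
    where open ≈ₚ-Reasoning
  powₚ-eᵥ (s V.∷ σ) (Fn.suc i) = ≈ₚ-trans (const-1#-*ₚ (powₚ σ (eᵥ i))) (powₚ-eᵥ σ i)

  subst-mono : ∀ {m k} (β : Monomial m) (σ : Vec (Poly k) m) → subst (mono β) σ ≈ₚ powₚ σ β
  subst-mono β σ = ⟪ (λ γ → begin
    coeff (subst (mono β) σ) γ       ≈⟨ coeff-subst (mono β) σ γ ⟩
    1# * coeff (powₚ σ β) γ ⊕ 0#     ≈⟨ trans (+-identityʳ _) (*-identityˡ _) ⟩
    coeff (powₚ σ β) γ               ∎) ⟫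
    where open ≈-Reasoning

  subst-var : ∀ {m k} (i : Fin m) (σ : Vec (Poly k) m) → subst (var i) σ ≈ₚ lookup σ i
  subst-var i σ = ≈ₚ-trans (≈ₚ-reflexive (Eq.cong (λ p → subst p σ) (var-≡ i)))
    (≈ₚ-trans (subst-mono (eᵥ i) σ) (powₚ-eᵥ σ i))

  subst-vars : ∀ {m} (p : Poly m) → subst p (tabulate var) ≈ₚ p
  subst-vars p = ⟪ (λ γ → begin
    coeff (subst p (tabulate var)) γ               ≈⟨ coeff-subst p (tabulate var) γ ⟩
    ⟨ p , (λ β → coeff (powₚ (tabulate var) β) γ) ⟩ ≈⟨ ∑-cong p (λ t → *-congˡ (trans (at (powₚ-vars (proj₁ t)) γ)
                                                                                        (coeff-mono (proj₁ t) γ))) ⟩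
    ⟨ p , (λ β → kron β γ 1#) ⟩                    ≈⟨ pairing≈coeff p γ ⟩
    coeff p γ                                      ∎) ⟫
    where open ≈-Reasoning

  pow-eᵥ : ∀ {m} (x : Vec Carrier m) i → pow x (eᵥ i) ≈ lookup x i
  pow-eᵥ (x V.∷ xs) Fn.zero    = trans (*-cong (*-identityʳ x) (pow-0ᵥ xs)) (*-identityʳ x)
  pow-eᵥ (x V.∷ xs) (Fn.suc i) = trans (*-identityˡ _) (pow-eᵥ xs i)

  eval-var : ∀ {m} (i : Fin m) x → eval (var i) x ≈ lookup x i
  eval-var i x = trans (eval-cong x (var-≈ i)) (trans (+-identityʳ _) (trans (*-identityˡ _) (pow-eᵥ x i)))

  -- Order and degree

  ∣+ᵥ∣ : ∀ {m} (α β : Monomial m) → ∣ α +ᵥ β ∣ₘ ≡ ∣ α ∣ₘ + ∣ β ∣ₘ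
  ∣+ᵥ∣ V.[]       V.[]       = Eq.refl
  ∣+ᵥ∣ (i V.∷ α) (j V.∷ β) = Eq.trans (Eq.cong (i + j +_) (∣+ᵥ∣ α β)) (ℕ-interchange i j ∣ α ∣ₘ ∣ β ∣ₘ)
    where open import Algebra.Properties.CommutativeSemigroup NP.+-commutativeSemigroup
            using () renaming (interchange to ℕ-interchange)

  -- Order≥ p M says mult(p, 0) ≥ M; mult(p, b) ≥ M is then Order≥ (translate b p) M.
  Order≥ : ∀ {m} → Poly m → ℕ → Set ℓ
  Order≥ p M = ∀ α → ∣ α ∣ₘ < M → coeff p α ≈ 0#

  Degree≤ : ∀ {m} → Poly m → ℕ → Set ℓ
  Degree≤ p D = ∀ α → D < ∣ α ∣ₘ → coeff p α ≈ 0#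

  coeff-*ₚ-vanishes : ∀ {m} (p r : Poly m) γ (A B : ℕ → Set) → (∀ n → Dec (A n)) → (∀ n → Dec (B n)) →
    (∀ β → A ∣ β ∣ₘ → coeff p β ≈ 0#) → (∀ β → B ∣ β ∣ₘ → coeff r β ≈ 0#) →
    (∀ i j → ¬ A i → ¬ B j → ¬ (i + j ≡ ∣ γ ∣ₘ)) → coeff (p *ₚ r) γ ≈ 0#
  coeff-*ₚ-vanishes p r γ A B A? B? p-vanishes r-vanishes disjoint =
    trans (coeff-*ₚ≈pairing p r γ) (pairing-vanishes p _ p⊥)
    where
      p⊥ : ∀ β → coeff p β ≈ 0# ⊎ shiftedCoeff r γ β ≈ 0#
      p⊥ β with A? ∣ β ∣ₘ
      ... | yes a = inj₁ (p-vanishes β a)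
      ... | no ¬a = inj₂ (trans (∑-cong r (λ u → sym (kron-*-1# (β +ᵥ proj₁ u) γ (proj₂ u))))
                                (pairing-vanishes r _ r⊥))
        where
          r⊥ : ∀ β′ → coeff r β′ ≈ 0# ⊎ kron (β +ᵥ β′) γ 1# ≈ 0#
          r⊥ β′ with B? ∣ β′ ∣ₘ
          ... | yes b = inj₁ (r-vanishes β′ b)
          ... | no ¬b = inj₂ (kron-∣∣ (β +ᵥ β′) γ 1#
                                (λ eq → disjoint _ _ ¬a ¬b (Eq.trans (Eq.sym (∣+ᵥ∣ β β′)) eq)))

  order≥-*ₚ : ∀ {m} (p r : Poly m) M₁ M₂ → Order≥ p M₁ → Order≥ r M₂ → Order≥ (p *ₚ r) (M₁ + M₂)
  order≥-*ₚ p r M₁ M₂ p-ord r-ord γ ∣γ∣< =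
    coeff-*ₚ-vanishes p r γ (_< M₁) (_< M₂) (N._<? M₁) (N._<? M₂) p-ord r-ord
      (λ i j i≮ j≮ eq → NP.<⇒≱ ∣γ∣< (Eq.subst (M₁ + M₂ ≤_) eq (NP.+-mono-≤ (NP.≮⇒≥ i≮) (NP.≮⇒≥ j≮))))

  degree≤-*ₚ : ∀ {m} (p r : Poly m) D₁ D₂ → Degree≤ p D₁ → Degree≤ r D₂ → Degree≤ (p *ₚ r) (D₁ + D₂)
  degree≤-*ₚ p r D₁ D₂ p-deg r-deg γ <∣γ∣ =
    coeff-*ₚ-vanishes p r γ (D₁ <_) (D₂ <_) (D₁ N.<?_) (D₂ N.<?_) p-deg r-deg
      (λ i j ≮i ≮j eq → NP.<⇒≱ <∣γ∣ (Eq.subst (_≤ D₁ + D₂) eq (NP.+-mono-≤ (NP.≮⇒≥ ≮i) (NP.≮⇒≥ ≮j))))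

  order≥-cong : ∀ {m} {p p′ : Poly m} {M} → p ≈ₚ p′ → Order≥ p M → Order≥ p′ M
  order≥-cong p≈p′ p-ord α ∣α∣< = trans (sym (at p≈p′ α)) (p-ord α ∣α∣<)

  degree≤-mono : ∀ {m} (p : Poly m) {D D′} → D ≤ D′ → Degree≤ p D → Degree≤ p D′
  degree≤-mono p D≤D′ p-deg α <∣α∣ = p-deg α (NP.≤-<-trans D≤D′ <∣α∣)

  order≥-+ₚ : ∀ {m} (p r : Poly m) {M} → Order≥ p M → Order≥ r M → Order≥ (p +ₚ r) M
  order≥-+ₚ p r p-ord r-ord α ∣α∣< =
    trans (coeff-++ p r α) (trans (+-cong (p-ord α ∣α∣<) (r-ord α ∣α∣<)) (+-identityˡ 0#))

  degree≤-+ₚ : ∀ {m} (p r : Poly m) {D} → Degree≤ p D → Degree≤ r D → Degree≤ (p +ₚ r) D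
  degree≤-+ₚ p r p-deg r-deg α <∣α∣ =
    trans (coeff-++ p r α) (trans (+-cong (p-deg α <∣α∣) (r-deg α <∣α∣)) (+-identityˡ 0#))

  degree≤-const : ∀ {m} a → Degree≤ (const {m} a) 0
  degree≤-const {m} a α 0<∣α∣ = trans (coeff-const a α)
    (kron-∣∣ 0ᵥ α a (λ eq → NP.<⇒≢ 0<∣α∣ (Eq.trans (Eq.sym (∣0ᵥ∣ {m})) eq)))

  order≥-var : ∀ {m} (i : Fin m) → Order≥ (var i) 1
  order≥-var i α ∣α∣<1 = trans (coeff-var i α)
    (kron-∣∣ (eᵥ i) α 1# (λ eq → NP.<⇒≢ ∣α∣<1 (Eq.trans (Eq.sym eq) (∣eᵥ∣ i))))

  degree≤-var : ∀ {m} (i : Fin m) → Degree≤ (var i) 1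
  degree≤-var i α 1<∣α∣ = trans (coeff-var i α)
    (kron-∣∣ (eᵥ i) α 1# (λ eq → NP.<⇒≢ 1<∣α∣ (Eq.trans (Eq.sym (∣eᵥ∣ i)) eq)))

  order≥-^ₚ : ∀ {m} (p : Poly m) M k → Order≥ p M → Order≥ (p ^ₚ k) (k N.* M)
  order≥-^ₚ p M N.zero    p-ord α ()
  order≥-^ₚ p M (N.suc k) p-ord = order≥-*ₚ p (p ^ₚ k) M (k N.* M) p-ord (order≥-^ₚ p M k p-ord)

  degree≤-^ₚ : ∀ {m} (p : Poly m) D k → Degree≤ p D → Degree≤ (p ^ₚ k) (k N.* D)
  degree≤-^ₚ p D N.zero    p-deg = degree≤-const 1#
  degree≤-^ₚ p D (N.suc k) p-deg = degree≤-*ₚ p (p ^ₚ k) D (k N.* D) p-deg (degree≤-^ₚ p D k p-deg)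

  order≥-powₚ : ∀ {m k} (σ : Vec (Poly k) m) → (∀ i → Order≥ (lookup σ i) 1) → ∀ β → Order≥ (powₚ σ β) ∣ β ∣ₘ
  order≥-powₚ V.[]       σ-ord V.[]       α ()
  order≥-powₚ (s V.∷ σ) σ-ord (i V.∷ β) = order≥-*ₚ (s ^ₚ i) (powₚ σ β) i ∣ β ∣ₘ
    (Eq.subst (Order≥ (s ^ₚ i)) (NP.*-identityʳ i) (order≥-^ₚ s 1 i (σ-ord Fn.zero)))
    (order≥-powₚ σ (λ j → σ-ord (Fn.suc j)) β)

  degree≤-powₚ : ∀ {m k} (σ : Vec (Poly k) m) l → (∀ i → Degree≤ (lookup σ i) l) →
                 ∀ β → Degree≤ (powₚ σ β) (∣ β ∣ₘ N.* l)
  degree≤-powₚ V.[]       l σ-deg V.[]       = degree≤-const 1#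
  degree≤-powₚ (s V.∷ σ) l σ-deg (i V.∷ β) =
    Eq.subst (Degree≤ (powₚ (s V.∷ σ) (i V.∷ β))) (Eq.sym (NP.*-distribʳ-+ l i ∣ β ∣ₘ))
    (degree≤-*ₚ (s ^ₚ i) (powₚ σ β) (i N.* l) (∣ β ∣ₘ N.* l)
      (degree≤-^ₚ s l i (σ-deg Fn.zero)) (degree≤-powₚ σ l (λ j → σ-deg (Fn.suc j)) β))

  coeff-subst-vanishes : ∀ {m k} (p : Poly m) (σ : Vec (Poly k) m) γ (A : ℕ → Set) → (∀ n → Dec (A n)) →
    (∀ β → A ∣ β ∣ₘ → coeff p β ≈ 0#) → (∀ β → ¬ A ∣ β ∣ₘ → coeff (powₚ σ β) γ ≈ 0#) →
    coeff (subst p σ) γ ≈ 0#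
  coeff-subst-vanishes p σ γ A A? p-vanishes σ-vanishes =
    trans (coeff-subst p σ γ) (pairing-vanishes p _ p⊥)
    where
      p⊥ : ∀ β → coeff p β ≈ 0# ⊎ coeff (powₚ σ β) γ ≈ 0#
      p⊥ β with A? ∣ β ∣ₘ
      ... | yes a = inj₁ (p-vanishes β a)
      ... | no ¬a = inj₂ (σ-vanishes β ¬a)

  order≥-subst : ∀ {m k} (p : Poly m) (σ : Vec (Poly k) m) M →
                 (∀ i → Order≥ (lookup σ i) 1) → Order≥ p M → Order≥ (subst p σ) M
  order≥-subst p σ M σ-ord p-ord γ ∣γ∣< = coeff-subst-vanishes p σ γ (_< M) (N._<? M) p-ord
    (λ β ∣β∣≮ → order≥-powₚ σ σ-ord β γ (NP.<-≤-trans ∣γ∣< (NP.≮⇒≥ ∣β∣≮)))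

  degree≤-subst : ∀ {m k} (p : Poly m) (σ : Vec (Poly k) m) l D →
                  (∀ i → Degree≤ (lookup σ i) l) → Degree≤ p D → Degree≤ (subst p σ) (D N.* l)
  degree≤-subst p σ l D σ-deg p-deg γ <∣γ∣ = coeff-subst-vanishes p σ γ (D <_) (D N.<?_) p-deg
    (λ β ≮∣β∣ → degree≤-powₚ σ l σ-deg β γ (NP.≤-<-trans (NP.*-monoˡ-≤ l (NP.≮⇒≥ ≮∣β∣)) <∣γ∣))

  order>degree⇒≈[] : ∀ {m} (p : Poly m) {δ r} → Degree≤ p δ → Order≥ p r → δ < r → p ≈ₚ []
  order>degree⇒≈[] p {δ} {r} p-deg p-ord δ<r = ⟪ (λ α → vanishes α (∣ α ∣ₘ N.<? r)) ⟫
    where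
      vanishes : ∀ α → Dec (∣ α ∣ₘ < r) → coeff p α ≈ 0#
      vanishes α (yes ∣α∣<r) = p-ord α ∣α∣<r
      vanishes α (no  ∣α∣≮r) = p-deg α (NP.<-≤-trans δ<r (NP.≮⇒≥ ∣α∣≮r))

  takeᵥ : ∀ {m m′} → Monomial (m + m′) → Monomial m
  takeᵥ {m} δ = proj₁ (V.splitAt m δ)

  dropᵥ : ∀ {m m′} → Monomial (m + m′) → Monomial m′
  dropᵥ {m} δ = proj₁ (proj₂ (V.splitAt m δ))

  ≡-takeᵥ++dropᵥ : ∀ {m m′} (δ : Monomial (m + m′)) → δ ≡ takeᵥ {m} δ ++ dropᵥ {m} δ
  ≡-takeᵥ++dropᵥ {m} δ = proj₂ (proj₂ (V.splitAt m δ))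

  kron-split : ∀ {m m′} (δ : Monomial (m + m′)) α β b →
               kron δ (α ++ β) b ≈ kron (takeᵥ {m} δ) α (kron (dropᵥ {m} δ) β b)
  kron-split {m} δ α β b = trans (kron-cong {β = δ} {α = α ++ β} (≡-takeᵥ++dropᵥ {m} δ) refl)
                                 (kron-++ (takeᵥ {m} δ) α (dropᵥ {m} δ) β b)

  ∣++∣ : ∀ {m m′} (α : Monomial m) (β : Monomial m′) → ∣ α ++ β ∣ₘ ≡ ∣ α ∣ₘ + ∣ β ∣ₘ
  ∣++∣ V.[]       β = Eq.refl
  ∣++∣ (i V.∷ α) β = Eq.trans (Eq.cong (i +_) (∣++∣ α β)) (Eq.sym (NP.+-assoc i _ _))

  0ᵥ++0ᵥ : ∀ {m m′} → 0ᵥ {m} ++ 0ᵥ {m′} ≡ 0ᵥ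
  0ᵥ++0ᵥ {N.zero}  = Eq.refl
  0ᵥ++0ᵥ {N.suc m} = Eq.cong (0 V.∷_) (0ᵥ++0ᵥ {m})

  coeff-coeffʸ : ∀ {m} (G : Poly (m + m)) (β α : Monomial m) → coeff (coeffʸ {m} G β) α ≈ coeff G (α ++ β)
  coeff-coeffʸ {m} [] β α = refl
  coeff-coeffʸ {m} ((δ , b) ∷ G) β α with V.splitAt m δ
  ... | (δx , δy , Eq.refl) with ≡-dec N._≟_ δy β
  ...   | yes δy≡β = begin
    coeff ((δx , b) ∷ coeffʸ {m} G β) α           ≈⟨ coeff-∷ δx b (coeffʸ {m} G β) α ⟩
    kron δx α b ⊕ coeff (coeffʸ {m} G β) α
      ≈⟨ +-cong (kron-cong {β = δx} {α = α} Eq.refl (sym (kron-≡ δy≡β b))) (coeff-coeffʸ {m} G β α) ⟩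
    kron δx α (kron δy β b) ⊕ coeff G (α ++ β) ≈⟨ +-congʳ (kron-++ δx α δy β b) ⟨
    kron (δx ++ δy) (α ++ β) b ⊕ coeff G (α ++ β) ≈⟨ coeff-∷ (δx ++ δy) b G (α ++ β) ⟨
    coeff ((δx ++ δy , b) ∷ G) (α ++ β)       ∎
    where open ≈-Reasoning
  ...   | no δy≢β = begin
    coeff (coeffʸ {m} G β) α                      ≈⟨ coeff-coeffʸ {m} G β α ⟩
    coeff G (α ++ β)                          ≈⟨ +-identityˡ _ ⟨
    0# ⊕ coeff G (α ++ β)
      ≈⟨ +-congʳ (kron-≢ {β = δx ++ δy} b (λ eq → δy≢β (VP.++-injectiveʳ δx α eq))) ⟨
    kron (δx ++ δy) (α ++ β) b ⊕ coeff G (α ++ β) ≈⟨ coeff-∷ (δx ++ δy) b G (α ++ β) ⟨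
    coeff ((δx ++ δy , b) ∷ G) (α ++ β)       ∎
    where open ≈-Reasoning

  coeffʸ-cong : ∀ {m} {G G′ : Poly (m + m)} (β : Monomial m) → G ≈ₚ G′ → coeffʸ {m} G β ≈ₚ coeffʸ {m} G′ β
  coeffʸ-cong {m} {G} {G′} β G≈G′ = ⟪ (λ α →
    trans (coeff-coeffʸ {m} G β α) (trans (at G≈G′ (α ++ β)) (sym (coeff-coeffʸ {m} G′ β α)))) ⟫

  pairing-coeffʸ : ∀ {m} (G : Poly (m + m)) (β : Monomial m) h →
    ⟨ coeffʸ {m} G β , h ⟩ ≈ ∑ G (λ t → kron (dropᵥ {m} (proj₁ t)) β (proj₂ t) * h (takeᵥ {m} (proj₁ t)))
  pairing-coeffʸ {m} G β h = trans (pairing-cong h coeffʸ≈map) (∑-map G _ _)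
    where
      -- a with-free presentation of coeffʸ
      Gʸ : Poly m
      Gʸ = L.map (λ t → takeᵥ {m} (proj₁ t) , kron (dropᵥ {m} (proj₁ t)) β (proj₂ t)) G
      coeffʸ≈map : coeffʸ {m} G β ≈ₚ Gʸ
      coeffʸ≈map = ⟪ (λ α → begin
        coeff (coeffʸ {m} G β) α  ≈⟨ coeff-coeffʸ {m} G β α ⟩
        coeff G (α ++ β)          ≈⟨ coeff≈∑ G (α ++ β) ⟩
        ∑ G (λ t → kron (proj₁ t) (α ++ β) (proj₂ t))
            ≈⟨ ∑-cong G (λ t → kron-split {m} (proj₁ t) α β (proj₂ t)) ⟩
        ∑ G (λ t → kron (takeᵥ {m} (proj₁ t)) α (kron (dropᵥ {m} (proj₁ t)) β (proj₂ t)))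
            ≈⟨ ∑-map G _ _ ⟨
        ∑ Gʸ (λ t → kron (proj₁ t) α (proj₂ t)) ≈⟨ coeff≈∑ Gʸ α ⟨
        coeff Gʸ α                ∎) ⟫
        where open ≈-Reasoning

  -- Renaming variables along a monoid morphism of exponents

  module Rename {m k} (φ : Monomial m → Monomial k)
                (φ-+ᵥ : ∀ α β → φ (α +ᵥ β) ≡ φ α +ᵥ φ β) (φ-0ᵥ : φ 0ᵥ ≡ 0ᵥ) where

    rename : Poly m → Poly k
    rename = L.map (λ t → φ (proj₁ t) , proj₂ t)

    coeff-rename : ∀ A γ → coeff (rename A) γ ≈ ⟨ A , (λ β → kron (φ β) γ 1#) ⟩
    coeff-rename A γ = trans (coeff≈∑ (rename A) γ)
      (trans (∑-map A _ _) (∑-cong A (λ t → sym (kron-*-1# (φ (proj₁ t)) γ (proj₂ t)))))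

    rename-cong : ∀ {A B} → A ≈ₚ B → rename A ≈ₚ rename B
    rename-cong {A} {B} A≈B = ⟪ (λ γ →
      trans (coeff-rename A γ) (trans (pairing-cong _ A≈B) (sym (coeff-rename B γ)))) ⟫

    rename-*ₚ : ∀ A B → rename (A *ₚ B) ≈ₚ (rename A *ₚ rename B)
    rename-*ₚ A B = ⟪ (λ γ → begin
      coeff (rename (A *ₚ B)) γ        ≈⟨ coeff≈∑ (rename (A *ₚ B)) γ ⟩
      ∑ (rename (A *ₚ B)) _            ≈⟨ trans (∑-map (A *ₚ B) _ _) (∑-*ₚ A B _) ⟩
      ∑ A (λ t → ∑ B _)                ≈⟨ ∑-cong A (λ t → ∑-cong B (λ u →
                                            kron-cong {α = γ} (φ-+ᵥ (proj₁ t) (proj₁ u)) refl)) ⟩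
      ∑ A (λ t → ∑ B _)                ≈⟨ ∑-cong A (λ t → ∑-map B _ _) ⟨
      ∑ A (λ t → ∑ (rename B) _)       ≈⟨ ∑-map A _ _ ⟨
      ∑ (rename A) (λ t → ∑ (rename B) _) ≈⟨ coeff-*ₚ (rename A) (rename B) γ ⟨
      coeff (rename A *ₚ rename B) γ   ∎) ⟫
      where open ≈-Reasoning

    rename-+ₚ : ∀ A B → rename (A +ₚ B) ≡ rename A +ₚ rename B
    rename-+ₚ = LP.map-++ _

    rename-const : ∀ a → rename (const a) ≡ const a
    rename-const a = Eq.cong (λ α → (α , a) ∷ []) φ-0ᵥ

    rename-^ₚ : ∀ A n → rename (A ^ₚ n) ≈ₚ (rename A ^ₚ n)
    rename-^ₚ A N.zero    = ≈ₚ-reflexive (rename-const 1#)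
    rename-^ₚ A (N.suc n) = ≈ₚ-trans (rename-*ₚ A (A ^ₚ n)) (*ₚ-congˡ (rename A) (rename-^ₚ A n))

    powₚ-rename : ∀ {j} (τ : Vec (Poly m) j) δ → powₚ (map rename τ) δ ≈ₚ rename (powₚ τ δ)
    powₚ-rename V.[]       V.[]       = ≈ₚ-sym (≈ₚ-reflexive (rename-const 1#))
    powₚ-rename (t V.∷ τ) (i V.∷ δ) = ≈ₚ-trans (*ₚ-cong (≈ₚ-sym (rename-^ₚ t i)) (powₚ-rename τ δ))
                                                (≈ₚ-sym (rename-*ₚ (t ^ₚ i) (powₚ τ δ)))

    rename-var : ∀ i j → φ (eᵥ i) ≡ eᵥ j → rename (var i) ≈ₚ var j
    rename-var i j φeᵢ≡eⱼ = ≈ₚ-reflexive (Eq.trans (Eq.cong rename (var-≡ i))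
      (Eq.trans (Eq.cong mono φeᵢ≡eⱼ) (Eq.sym (var-≡ j))))

  module Liftˡ {m m′} = Rename {m} {m + m′} (_++ 0ᵥ)
    (λ α β → Eq.trans (Eq.cong ((α +ᵥ β) ++_) (Eq.sym (+ᵥ-identityˡ 0ᵥ))) (Eq.sym (VP.zipWith-++ N._+_ α (0ᵥ {m′}) β 0ᵥ)))
    (0ᵥ++0ᵥ {m})
    renaming (rename to liftˡ)

  module Liftʳ {m m′} = Rename {m′} {m + m′} (0ᵥ {m} ++_)
    (λ α β → Eq.trans (Eq.cong (_++ (α +ᵥ β)) (Eq.sym (+ᵥ-identityˡ 0ᵥ))) (Eq.sym (VP.zipWith-++ N._+_ (0ᵥ {m}) α 0ᵥ β)))
    (0ᵥ++0ᵥ {m})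
    renaming (rename to liftʳ)

  open Liftˡ using (liftˡ)
  open Liftʳ using (liftʳ)

  coeff-liftˡ-*ₚ-liftʳ : ∀ {m m′} (A : Poly m) (B : Poly m′) α β →
                        coeff (liftˡ {m} {m′} A *ₚ liftʳ {m} B) (α ++ β) ≈ coeff A α * coeff B β
  coeff-liftˡ-*ₚ-liftʳ {m} {m′} A B α β = begin
    coeff (liftˡ A *ₚ liftʳ B) (α ++ β)
      ≈⟨ trans (coeff-*ₚ (liftˡ {m} {m′} A) (liftʳ {m} B) (α ++ β)) (trans (∑-map A _ _) (∑-cong A (λ t → ∑-map B _ _))) ⟩
    ∑ A (λ t → ∑ B (λ u → kron ((proj₁ t ++ 0ᵥ) +ᵥ (0ᵥ ++ proj₁ u)) (α ++ β) (proj₂ t * proj₂ u)))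
      ≈⟨ ∑-cong A (λ t → ∑-cong B (λ u → term (proj₁ t) (proj₁ u) (proj₂ t) (proj₂ u))) ⟩
    ∑ A (λ t → ∑ B (λ u → kron (proj₁ t) α (proj₂ t) * kron (proj₁ u) β (proj₂ u)))
      ≈⟨ ∑-cong A (λ t → *-distribˡ-∑ B _ _) ⟨
    ∑ A (λ t → kron (proj₁ t) α (proj₂ t) * ∑ B _)   ≈⟨ *-distribʳ-∑ A _ _ ⟨
    ∑ A _ * ∑ B _                                    ≈⟨ *-cong (coeff≈∑ A α) (coeff≈∑ B β) ⟨
    coeff A α * coeff B β                            ∎
    where
      open ≈-Reasoning
      term : ∀ x y a b → kron ((x ++ 0ᵥ) +ᵥ (0ᵥ ++ y)) (α ++ β) (a * b) ≈ kron x α a * kron y β b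
      term x y a b = begin
        kron ((x ++ 0ᵥ) +ᵥ (0ᵥ ++ y)) (α ++ β) (a * b)
          ≈⟨ kron-cong {α = α ++ β} (Eq.trans (VP.zipWith-++ N._+_ x 0ᵥ 0ᵥ y)
                                       (Eq.cong₂ _++_ (+ᵥ-identityʳ x) (+ᵥ-identityˡ y))) refl ⟩
        kron (x ++ y) (α ++ β) (a * b)  ≈⟨ kron-++ x α y β _ ⟩
        kron x α (kron y β (a * b))     ≈⟨ kron-*-kron x α y β a b ⟩
        kron x α a * kron y β b         ∎

  powₚ-split : ∀ {k j j′} (u : Vec (Poly k) j) (v : Vec (Poly k) j′) δ →
               powₚ (u ++ v) δ ≈ₚ (powₚ u (takeᵥ {j} δ) *ₚ powₚ v (dropᵥ {j} δ))
  powₚ-split {j = j} u v δ = ≈ₚ-trans (≈ₚ-reflexive (Eq.cong (powₚ (u ++ v)) (≡-takeᵥ++dropᵥ {j} δ)))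
                                      (powₚ-++ u v (takeᵥ {j} δ) (dropᵥ {j} δ))

  powₚ-const : ∀ {m k} (x : Vec Carrier m) β → powₚ (map (const {k}) x) β ≈ₚ const (pow x β)
  powₚ-const V.[]       V.[]       = ≈ₚ-refl
  powₚ-const (a V.∷ x) (i V.∷ β) = ≈ₚ-trans (*ₚ-cong (const-^ₚ a i) (powₚ-const x β)) (const-*ₚ-const _ _)
    where
      const-^ₚ : ∀ {k} a i → (const {k} a ^ₚ i) ≈ₚ const (a ^ᴿ i)
      const-^ₚ a N.zero    = ≈ₚ-refl
      const-^ₚ a (N.suc i) = ≈ₚ-trans (*ₚ-congˡ (const a) (const-^ₚ a i)) (const-*ₚ-const a (a ^ᴿ i))

  -- Translation and Hasse derivatives

  translation : ∀ {m} → Vec Carrier m → Vec (Poly m) m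
  translation c = zipWith _+ₚ_ (map const c) (tabulate var)

  translate : ∀ {m} → Vec Carrier m → Poly m → Poly m
  translate c p = subst p (translation c)

  lookup-translation : ∀ {m} (c : Vec Carrier m) i → lookup (translation c) i ≡ const (lookup c i) +ₚ var i
  lookup-translation c i = Eq.trans (VP.lookup-zipWith _+ₚ_ i (map const c) (tabulate var))
    (Eq.cong₂ _+ₚ_ (VP.lookup-map i const c) (VP.lookup∘tabulate var i))

  subst-translate : ∀ {m k} (c : Vec Carrier m) (Q : Poly m) (ψ : Vec (Poly k) m) →
                    subst (translate c Q) ψ ≈ₚ subst Q (zipWith _+ₚ_ (map const c) ψ)
  subst-translate c Q ψ = ≈ₚ-trans (subst-subst Q (translation c) ψ)
    (subst-congʳ Q {map (λ s → subst s ψ) (translation c)} {zipWith _+ₚ_ (map const c) ψ} (λ i → begin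
      lookup (map (λ s → subst s ψ) (translation c)) i  ≡⟨ VP.lookup-map i _ (translation c) ⟩
      subst (lookup (translation c) i) ψ                ≡⟨ Eq.cong (λ s → subst s ψ) (lookup-translation c i) ⟩
      subst (const (lookup c i) +ₚ var i) ψ             ≈⟨ subst-+ₚ (const (lookup c i)) (var i) ψ ⟩
      subst (const (lookup c i)) ψ +ₚ subst (var i) ψ   ≈⟨ +ₚ-cong (subst-const (lookup c i) ψ) (subst-var i ψ) ⟩
      const (lookup c i) +ₚ lookup ψ i                  ≡⟨ Eq.cong (_+ₚ lookup ψ i) (VP.lookup-map i const c) ⟨
      lookup (map const c) i +ₚ lookup ψ i              ≡⟨ VP.lookup-zipWith _+ₚ_ i (map const c) ψ ⟨
      lookup (zipWith _+ₚ_ (map const c) ψ) i           ∎))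
    where open ≈ₚ-Reasoning

  xy : ∀ {m} → Vec (Poly (m + m)) m
  xy {m} = tabulate (λ i → var (i Fn.↑ˡ m) +ₚ var (m Fn.↑ʳ i))

  lookup-xy : ∀ {m} (i : Fin m) → lookup (xy {m}) i ≡ var (i Fn.↑ˡ m) +ₚ var (m Fn.↑ʳ i)
  lookup-xy {m} i = VP.lookup∘tabulate (λ i → var (i Fn.↑ˡ m) +ₚ var (m Fn.↑ʳ i)) i

  subst-lookup-xy : ∀ {m k} (ν : Vec (Poly k) (m + m)) (i : Fin m) →
    subst (lookup (xy {m}) i) ν ≈ₚ (lookup ν (i Fn.↑ˡ m) +ₚ lookup ν (m Fn.↑ʳ i))
  subst-lookup-xy {m} ν i = ≈ₚ-trans (≈ₚ-reflexive (Eq.cong (λ q → subst q ν) (lookup-xy i)))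
    (≈ₚ-trans (subst-+ₚ (var (i Fn.↑ˡ m)) (var (m Fn.↑ʳ i)) ν)
              (+ₚ-cong (subst-var (i Fn.↑ˡ m) ν) (subst-var (m Fn.↑ʳ i) ν)))

  *-kron-rearrange : ∀ {m} b M (y γ : Monomial m) → b * (M * kron y γ 1#) ≈ kron y γ b * M
  *-kron-rearrange b M y γ = trans (*-congˡ (*-comm M _)) (trans (sym (*-assoc b _ M))
    (*-congʳ (kron-*-1# y γ b)))

  eval-coeffʸ : ∀ {m} (G : Poly (m + m)) (γ : Monomial m) c →
                eval (coeffʸ {m} G γ) c ≈ coeff (subst G (map const c ++ tabulate var)) γ
  eval-coeffʸ {m} G γ c = begin
    eval (coeffʸ {m} G γ) c                         ≈⟨ pairing-coeffʸ G γ (pow c) ⟩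
    ∑ G (λ t → kron (dropᵥ {m} (proj₁ t)) γ (proj₂ t) * pow c (takeᵥ {m} (proj₁ t)))
        ≈⟨ ∑-cong G (λ t → term (proj₁ t) (proj₂ t)) ⟨
    ⟨ G , (λ δ → coeff (powₚ ν δ) γ) ⟩              ≈⟨ coeff-subst G ν γ ⟨
    coeff (subst G ν) γ                             ∎
    where
      open ≈-Reasoning
      ν = map const c ++ tabulate var
      powν : ∀ δ → powₚ ν δ ≈ₚ (const (pow c (takeᵥ {m} δ)) *ₚ mono (dropᵥ {m} δ))
      powν δ = ≈ₚ-trans (powₚ-split (map const c) (tabulate var) δ)
        (*ₚ-cong (powₚ-const c (takeᵥ {m} δ)) (powₚ-vars (dropᵥ {m} δ)))
      term : ∀ δ b → b * coeff (powₚ ν δ) γ ≈ kron (dropᵥ {m} δ) γ b * pow c (takeᵥ {m} δ)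
      term δ b = trans (*-congˡ (trans (at (powν δ) γ)
                                 (trans (const-*ₚ _ (mono (dropᵥ {m} δ)) γ) (*-congˡ (coeff-mono (dropᵥ {m} δ) γ)))))
                       (*-kron-rearrange b _ (dropᵥ {m} δ) γ)

  eval-hasse : ∀ {m} (Q : Poly m) (γ : Monomial m) c → eval (hasse Q γ) c ≈ coeff (translate c Q) γ
  eval-hasse {m} Q γ c = trans (eval-coeffʸ {m} (shift Q) γ c) (at (begin
    subst (subst Q xy) ν          ≈⟨ subst-subst Q xy ν ⟩
    subst Q (map (λ s → subst s ν) xy) ≈⟨ subst-congʳ Q {map (λ s → subst s ν) xy} {translation c} pointwise ⟩
    translate c Q                 ∎) γ)
    where
      open ≈ₚ-Reasoning
      ν = map const c ++ tabulate var
      pointwise : ∀ i → lookup (map (λ s → subst s ν) (xy {m})) i ≈ₚ lookup (translation c) i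
      pointwise i = begin
        lookup (map (λ s → subst s ν) xy) i            ≡⟨ VP.lookup-map i (λ s → subst s ν) xy ⟩
        subst (lookup xy i) ν                          ≈⟨ subst-lookup-xy ν i ⟩
        lookup ν (i Fn.↑ˡ m) +ₚ lookup ν (m Fn.↑ʳ i)  ≡⟨ Eq.cong₂ _+ₚ_
                                                          (Eq.trans (VP.lookup-++ˡ (map const c) (tabulate var) i) (VP.lookup-map i const c))
                                                          (Eq.trans (VP.lookup-++ʳ (map const c) (tabulate var) i) (VP.lookup∘tabulate var i)) ⟩
        const (lookup c i) +ₚ var i                    ≡⟨ lookup-translation c i ⟨
        lookup (translation c) i                       ∎

  multAtLeast⇒order≥ : ∀ {m} (Q : Poly m) c M → MultAtLeast Q c M → Order≥ (translate c Q) M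
  multAtLeast⇒order≥ Q c M Q-mult γ ∣γ∣< = trans (sym (eval-hasse Q γ c)) (Q-mult γ ∣γ∣<)

  -- the substitution (x , y) ↦ (x + c , y)
  translateˣ : ∀ {m} → Vec Carrier m → Vec (Poly (m + m)) (m + m)
  translateˣ {m} c = map (liftˡ {m} {m}) (translation c) ++ map (liftʳ {m} {m}) (tabulate var)

  translate-coeffʸ : ∀ {m} (G : Poly (m + m)) (β : Monomial m) c →
                     translate c (coeffʸ {m} G β) ≈ₚ coeffʸ {m} (subst G (translateˣ c)) β
  translate-coeffʸ {m} G β c = ⟪ (λ α → begin
    coeff (translate c (coeffʸ {m} G β)) α                ≈⟨ coeff-subst (coeffʸ {m} G β) (translation c) α ⟩
    ⟨ coeffʸ {m} G β , (λ δ → coeff (powₚ (translation c) δ) α) ⟩ ≈⟨ pairing-coeffʸ G β _ ⟩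
    ∑ G (λ t → kron (dropᵥ {m} (proj₁ t)) β (proj₂ t) * coeff (powₚ (translation c) (takeᵥ {m} (proj₁ t))) α)
        ≈⟨ ∑-cong G (λ t → term α (proj₁ t) (proj₂ t)) ⟨
    ⟨ G , (λ δ → coeff (powₚ (translateˣ c) δ) (α ++ β)) ⟩  ≈⟨ coeff-subst G (translateˣ c) (α ++ β) ⟨
    coeff (subst G (translateˣ c)) (α ++ β)               ≈⟨ coeff-coeffʸ {m} (subst G (translateˣ c)) β α ⟨
    coeff (coeffʸ {m} (subst G (translateˣ c)) β) α       ∎) ⟫
    where
      open ≈-Reasoning
      powᵀ : ∀ δ → powₚ (translateˣ c) δ ≈ₚ
                   (liftˡ {m} {m} (powₚ (translation c) (takeᵥ {m} δ)) *ₚ liftʳ {m} (mono (dropᵥ {m} δ)))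
      powᵀ δ = ≈ₚ-trans (powₚ-split (map (liftˡ {m} {m}) (translation c)) (map (liftʳ {m} {m}) (tabulate var)) δ)
        (*ₚ-cong (Liftˡ.powₚ-rename {m} {m} (translation c) (takeᵥ {m} δ))
                 (≈ₚ-trans (Liftʳ.powₚ-rename {m} (tabulate var) (dropᵥ {m} δ))
                           (Liftʳ.rename-cong {m} (powₚ-vars (dropᵥ {m} δ)))))
      term : ∀ α δ b → b * coeff (powₚ (translateˣ c) δ) (α ++ β) ≈
                       kron (dropᵥ {m} δ) β b * coeff (powₚ (translation c) (takeᵥ {m} δ)) α
      term α δ b = trans (*-congˡ (trans (at (powᵀ δ) (α ++ β))
        (trans (coeff-liftˡ-*ₚ-liftʳ (powₚ (translation c) (takeᵥ {m} δ)) (mono (dropᵥ {m} δ)) α β)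
               (*-congˡ (coeff-mono (dropᵥ {m} δ) β)))))
        (*-kron-rearrange b _ (dropᵥ {m} δ) β)

  eᵥ-↑ˡ : ∀ {m m′} (i : Fin m) → eᵥ i ++ 0ᵥ ≡ eᵥ (i Fn.↑ˡ m′)
  eᵥ-↑ˡ {N.suc m} {m′} Fn.zero = Eq.cong (1 V.∷_) (0ᵥ++0ᵥ {m} {m′})
  eᵥ-↑ˡ (Fn.suc i) = Eq.cong (0 V.∷_) (eᵥ-↑ˡ i)

  eᵥ-↑ʳ : ∀ {m′} m (i : Fin m′) → 0ᵥ {m} ++ eᵥ i ≡ eᵥ (m Fn.↑ʳ i)
  eᵥ-↑ʳ N.zero    i = Eq.refl
  eᵥ-↑ʳ (N.suc m) i = Eq.cong (0 V.∷_) (eᵥ-↑ʳ m i)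

  lookup-translateˣ-↑ˡ : ∀ {m} (c : Vec Carrier m) i →
                         lookup (translateˣ c) (i Fn.↑ˡ m) ≈ₚ (const (lookup c i) +ₚ var (i Fn.↑ˡ m))
  lookup-translateˣ-↑ˡ {m} c i = begin
    lookup (translateˣ c) (i Fn.↑ˡ m)              ≡⟨ VP.lookup-++ˡ (map (liftˡ {m} {m}) (translation c)) _ i ⟩
    lookup (map (liftˡ {m} {m}) (translation c)) i ≡⟨ VP.lookup-map i (liftˡ {m} {m}) (translation c) ⟩
    liftˡ {m} {m} (lookup (translation c) i)       ≡⟨ Eq.cong (liftˡ {m} {m}) (lookup-translation c i) ⟩
    liftˡ {m} {m} (const (lookup c i) +ₚ var i)    ≡⟨ Liftˡ.rename-+ₚ {m} {m} (const (lookup c i)) (var i) ⟩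
    liftˡ {m} {m} (const (lookup c i)) +ₚ liftˡ {m} {m} (var i)
      ≈⟨ +ₚ-cong (≈ₚ-reflexive (Liftˡ.rename-const {m} {m} (lookup c i))) (Liftˡ.rename-var {m} {m} i (i Fn.↑ˡ m) (eᵥ-↑ˡ i)) ⟩
    const (lookup c i) +ₚ var (i Fn.↑ˡ m)          ∎
    where open ≈ₚ-Reasoning

  lookup-translateˣ-↑ʳ : ∀ {m} (c : Vec Carrier m) i → lookup (translateˣ c) (m Fn.↑ʳ i) ≈ₚ var (m Fn.↑ʳ i)
  lookup-translateˣ-↑ʳ {m} c i = begin
    lookup (translateˣ c) (m Fn.↑ʳ i)              ≡⟨ VP.lookup-++ʳ (map (liftˡ {m} {m}) (translation c)) _ i ⟩
    lookup (map (liftʳ {m} {m}) (tabulate var)) i  ≡⟨ VP.lookup-map i (liftʳ {m}) (tabulate var) ⟩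
    liftʳ {m} (lookup (tabulate var) i)            ≡⟨ Eq.cong (liftʳ {m}) (VP.lookup∘tabulate var i) ⟩
    liftʳ {m} (var i)                              ≈⟨ Liftʳ.rename-var {m} i (m Fn.↑ʳ i) (eᵥ-↑ʳ m i) ⟩
    var (m Fn.↑ʳ i)                                ∎
    where open ≈ₚ-Reasoning

  subst-shift : ∀ {m} (f : Poly m) c → subst (shift f) (translateˣ c) ≈ₚ shift (translate c f)
  subst-shift {m} f c = begin
    subst (subst f xy) (translateˣ c)                ≈⟨ subst-subst f xy (translateˣ c) ⟩
    subst f (map (λ s → subst s (translateˣ c)) xy)  ≈⟨ subst-congʳ f {map (λ s → subst s (translateˣ c)) xy}
                                                                     {zipWith _+ₚ_ (map const c) xy} pointwise ⟩
    subst f (zipWith _+ₚ_ (map const c) xy)          ≈⟨ subst-translate c f xy ⟨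
    subst (translate c f) xy                         ∎
    where
      pointwise : ∀ i → lookup (map (λ s → subst s (translateˣ c)) xy) i ≈ₚ lookup (zipWith _+ₚ_ (map const c) (xy {m})) i
      pointwise i = begin
        lookup (map (λ s → subst s (translateˣ c)) xy) i  ≡⟨ VP.lookup-map i _ xy ⟩
        subst (lookup xy i) (translateˣ c)                ≈⟨ subst-lookup-xy (translateˣ c) i ⟩
        lookup (translateˣ c) (i Fn.↑ˡ m) +ₚ lookup (translateˣ c) (m Fn.↑ʳ i)
          ≈⟨ +ₚ-cong (lookup-translateˣ-↑ˡ c i) (lookup-translateˣ-↑ʳ c i) ⟩
        (const (lookup c i) +ₚ var (i Fn.↑ˡ m)) +ₚ var (m Fn.↑ʳ i)
          ≡⟨ LP.++-assoc (const (lookup c i)) (var (i Fn.↑ˡ m)) (var (m Fn.↑ʳ i)) ⟩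
        const (lookup c i) +ₚ (var (i Fn.↑ˡ m) +ₚ var (m Fn.↑ʳ i))
          ≡⟨ Eq.cong₂ _+ₚ_ (VP.lookup-map i const c) (lookup-xy i) ⟨
        lookup (map const c) i +ₚ lookup xy i             ≡⟨ VP.lookup-zipWith _+ₚ_ i (map const c) xy ⟨
        lookup (zipWith _+ₚ_ (map const c) xy) i          ∎
        where open ≈ₚ-Reasoning
      open ≈ₚ-Reasoning

  translate-hasse : ∀ {m} (f : Poly m) (β : Monomial m) c → translate c (hasse f β) ≈ₚ hasse (translate c f) β
  translate-hasse {m} f β c =
    ≈ₚ-trans (translate-coeffʸ {m} (shift f) β c) (coeffʸ-cong {m} β (subst-shift f c))

  -- Each xᵢ ↦ xᵢ + yᵢ is homogeneous of degree 1, so the coefficients of shift F of total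
  -- degree j come from those of F of degree j.
  coeff-shift-vanishes : ∀ {m} (F : Poly m) (γ : Monomial (m + m)) →
    (∀ β → ∣ β ∣ₘ ≡ ∣ γ ∣ₘ → coeff F β ≈ 0#) → coeff (shift F) γ ≈ 0#
  coeff-shift-vanishes {m} F γ F-vanishes =
    coeff-subst-vanishes F xy γ (_≡ ∣ γ ∣ₘ) (N._≟ ∣ γ ∣ₘ) F-vanishes xy^β-vanishes
    where
      xy-order : ∀ i → Order≥ (lookup (xy {m}) i) 1
      xy-order i = Eq.subst (λ q → Order≥ q 1) (Eq.sym (lookup-xy i))
        (order≥-+ₚ (var (i Fn.↑ˡ m)) (var (m Fn.↑ʳ i)) (order≥-var _) (order≥-var _))
      xy-degree : ∀ i → Degree≤ (lookup (xy {m}) i) 1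
      xy-degree i = Eq.subst (λ q → Degree≤ q 1) (Eq.sym (lookup-xy i))
        (degree≤-+ₚ (var (i Fn.↑ˡ m)) (var (m Fn.↑ʳ i)) (degree≤-var _) (degree≤-var _))
      xy^β-vanishes : ∀ β → ¬ ∣ β ∣ₘ ≡ ∣ γ ∣ₘ → coeff (powₚ xy β) γ ≈ 0#
      xy^β-vanishes β ∣β∣≢∣γ∣ with NP.<-cmp ∣ γ ∣ₘ ∣ β ∣ₘ
      ... | tri< ∣γ∣<∣β∣ _ _ = order≥-powₚ xy xy-order β γ ∣γ∣<∣β∣
      ... | tri≈ _ ∣γ∣≡∣β∣ _ = ⊥-elim (∣β∣≢∣γ∣ (Eq.sym ∣γ∣≡∣β∣))
      ... | tri> _ _ ∣β∣<∣γ∣ = degree≤-powₚ xy 1 xy-degree β γ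
                                 (Eq.subst (_< ∣ γ ∣ₘ) (Eq.sym (NP.*-identityʳ _)) ∣β∣<∣γ∣)

  coeff-hasse-vanishes : ∀ {m} (F : Poly m) (β α : Monomial m) →
    (∀ β′ → ∣ β′ ∣ₘ ≡ ∣ α ∣ₘ + ∣ β ∣ₘ → coeff F β′ ≈ 0#) → coeff (hasse F β) α ≈ 0#
  coeff-hasse-vanishes {m} F β α F-vanishes = trans (coeff-coeffʸ {m} (shift F) β α)
    (coeff-shift-vanishes F (α ++ β) (λ β′ eq → F-vanishes β′ (Eq.trans eq (∣++∣ α β))))

  order≥-hasse : ∀ {m} (F : Poly m) M (β : Monomial m) → Order≥ F M → Order≥ (hasse F β) (M N.∸ ∣ β ∣ₘ)
  order≥-hasse F M β F-ord α ∣α∣< = coeff-hasse-vanishes F β α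
    (λ β′ eq → F-ord β′ (Eq.subst (_< M) (Eq.sym eq) (m<o∸n⇒m+n<o ∣α∣<)))

  degree≤-hasse : ∀ {m} (F : Poly m) D (β : Monomial m) → Degree≤ F D → Degree≤ (hasse F β) (D N.∸ ∣ β ∣ₘ)
  degree≤-hasse F D β F-deg α <∣α∣ = coeff-hasse-vanishes F β α
    (λ β′ eq → F-deg β′ (Eq.subst (D <_) (Eq.sym eq) (m∸n<o⇒m<o+n <∣α∣)))

  translate-cong : ∀ {m} {c c′ : Vec Carrier m} (p : Poly m) →
                   (∀ i → lookup c i ≈ lookup c′ i) → translate c p ≈ₚ translate c′ p
  translate-cong {c = c} {c′} p c≈c′ = subst-congʳ p {translation c} {translation c′} (λ i →
    ≈ₚ-trans (≈ₚ-reflexive (lookup-translation c i))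
      (≈ₚ-trans (+ₚ-cong (const-cong (c≈c′ i)) (≈ₚ-refl {p = var i})) (≈ₚ-sym (≈ₚ-reflexive (lookup-translation c′ i)))))

  translate-0# : ∀ {m} (p : Poly m) → translate (V.replicate m 0#) p ≈ₚ p
  translate-0# {m} p = ≈ₚ-trans (subst-congʳ p {translation (V.replicate m 0#)} {tabulate var} (λ i → begin
    lookup (translation (V.replicate m 0#)) i ≡⟨ lookup-translation (V.replicate m 0#) i ⟩
    const (lookup (V.replicate m 0#) i) +ₚ var i ≡⟨ Eq.cong (λ a → const a +ₚ var i) (VP.lookup-replicate i 0#) ⟩
    const 0# +ₚ var i                        ≈⟨ +ₚ-cong const-0# (≈ₚ-refl {p = var i}) ⟩
    var i                                    ≡⟨ VP.lookup∘tabulate var i ⟨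
    lookup (tabulate var) i                  ∎)) (subst-vars p)
    where open ≈ₚ-Reasoning

  translate-translate : ∀ {m} (x y : Vec Carrier m) (p : Poly m) →
                        translate x (translate y p) ≈ₚ translate (zipWith _⊕_ y x) p
  translate-translate x y p = ≈ₚ-trans (subst-subst p (translation y) (translation x))
    (subst-congʳ p {map (λ s → translate x s) (translation y)} {translation (zipWith _⊕_ y x)} (λ i → begin
      lookup (map (translate x) (translation y)) i            ≡⟨ VP.lookup-map i (translate x) (translation y) ⟩
      translate x (lookup (translation y) i)                  ≡⟨ Eq.cong (translate x) (lookup-translation y i) ⟩
      translate x (const (lookup y i) +ₚ var i)               ≈⟨ subst-+ₚ (const (lookup y i)) (var i) (translation x) ⟩
      translate x (const (lookup y i)) +ₚ translate x (var i) ≈⟨ +ₚ-cong (subst-const (lookup y i) (translation x))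
                                                                          (subst-var i (translation x)) ⟩
      const (lookup y i) +ₚ lookup (translation x) i          ≡⟨ Eq.cong (const (lookup y i) +ₚ_) (lookup-translation x i) ⟩
      const (lookup y i) +ₚ (const (lookup x i) +ₚ var i)     ≡⟨ LP.++-assoc (const (lookup y i)) (const (lookup x i)) (var i) ⟨
      (const (lookup y i) +ₚ const (lookup x i)) +ₚ var i     ≈⟨ +ₚ-cong (const-+ₚ-const _ _) (≈ₚ-refl {p = var i}) ⟩
      const (lookup y i ⊕ lookup x i) +ₚ var i                ≡⟨ Eq.cong (λ a → const a +ₚ var i) (VP.lookup-zipWith _⊕_ i y x) ⟨
      const (lookup (zipWith _⊕_ y x) i) +ₚ var i             ≡⟨ lookup-translation (zipWith _⊕_ y x) i ⟨
      lookup (translation (zipWith _⊕_ y x)) i                ∎))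
    where open ≈ₚ-Reasoning

  translate-neg-translate : ∀ {m} (a : Vec Carrier m) (p : Poly m) → translate (map -_ a) (translate a p) ≈ₚ p
  translate-neg-translate {m} a p = begin
    translate (map -_ a) (translate a p)    ≈⟨ translate-translate (map -_ a) a p ⟩
    translate (zipWith _⊕_ a (map -_ a)) p  ≈⟨ translate-cong {c = zipWith _⊕_ a (map -_ a)} {V.replicate m 0#} p a-a≈0 ⟩
    translate (V.replicate m 0#) p          ≈⟨ translate-0# p ⟩
    p                                       ∎
    where
      open ≈ₚ-Reasoning
      a-a≈0 : ∀ i → lookup (zipWith _⊕_ a (map -_ a)) i ≈ lookup (V.replicate m 0#) i
      a-a≈0 i = trans (reflexive (Eq.trans (VP.lookup-zipWith _⊕_ i a (map -_ a)) (Eq.cong (lookup a i ⊕_) (VP.lookup-map i -_ a))))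
        (trans (-‿inverseʳ (lookup a i)) (reflexive (Eq.sym (VP.lookup-replicate i 0#))))

  degree≤-translate : ∀ {m} (c : Vec Carrier m) (p : Poly m) D → Degree≤ p D → Degree≤ (translate c p) D
  degree≤-translate c p D p-deg = Eq.subst (Degree≤ (translate c p)) (NP.*-identityʳ D)
    (degree≤-subst p (translation c) 1 D translation-degree p-deg)
    where
      translation-degree : ∀ i → Degree≤ (lookup (translation c) i) 1
      translation-degree i = Eq.subst (λ q → Degree≤ q 1) (Eq.sym (lookup-translation c i))
        (degree≤-+ₚ (const (lookup c i)) (var i) (degree≤-mono (const (lookup c i)) N.z≤n (degree≤-const (lookup c i))) (degree≤-var i))

  coeff-0ᵥ≈eval-origin : ∀ {m} (p : Poly m) → coeff p 0ᵥ ≈ eval p (V.replicate m 0#)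
  coeff-0ᵥ≈eval-origin {m} p = trans (coeff≈∑ p 0ᵥ) (∑-cong p (λ t → begin
    kron (proj₁ t) 0ᵥ (proj₂ t)        ≈⟨ kron-*-1# (proj₁ t) 0ᵥ (proj₂ t) ⟨
    proj₂ t * kron (proj₁ t) 0ᵥ 1#     ≈⟨ *-congˡ (pow-origin (proj₁ t)) ⟨
    proj₂ t * pow (V.replicate m 0#) (proj₁ t) ∎))
    where
      open ≈-Reasoning
      pow-origin : ∀ {m} (β : Monomial m) → pow (V.replicate m 0#) β ≈ kron β 0ᵥ 1#
      pow-origin V.[] = sym (kron-≡ {β = V.[]} Eq.refl 1#)
      pow-origin {N.suc m} (N.zero V.∷ β) =
        trans (*-identityˡ _) (trans (pow-origin β) (kron-∷ 0 β (0ᵥ {m}) 1#))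
      pow-origin {N.suc m} (N.suc i V.∷ β) = trans (trans (*-congʳ (zeroˡ _)) (zeroˡ _))
        (sym (kron-≢ {β = N.suc i V.∷ β} {α = 0ᵥ} 1# (λ eq → NP.1+n≢0 (VP.∷-injectiveˡ eq))))

  coeff-0ᵥ-translate : ∀ {m} (c : Vec Carrier m) (s : Poly m) → coeff (translate c s) 0ᵥ ≈ eval s c
  coeff-0ᵥ-translate {m} c s = begin
    coeff (translate c s) 0ᵥ                           ≈⟨ coeff-0ᵥ≈eval-origin (translate c s) ⟩
    eval (translate c s) 0s                            ≈⟨ eval-subst s (translation c) 0s ⟩
    eval s (map (λ t → eval t 0s) (translation c))     ≈⟨ eval-congʳ s {map (λ t → eval t 0s) (translation c)} {c} pointwise ⟩
    eval s c                                           ∎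
    where
      open ≈-Reasoning
      0s = V.replicate m 0#
      pointwise : ∀ i → lookup (map (λ t → eval t 0s) (translation c)) i ≈ lookup c i
      pointwise i = begin
        lookup (map (λ t → eval t 0s) (translation c)) i  ≡⟨ VP.lookup-map i (λ t → eval t 0s) (translation c) ⟩
        eval (lookup (translation c) i) 0s                ≡⟨ Eq.cong (λ t → eval t 0s) (lookup-translation c i) ⟩
        eval (const (lookup c i) +ₚ var i) 0s             ≈⟨ eval-+ₚ (const (lookup c i)) (var i) 0s ⟩
        eval (const (lookup c i)) 0s ⊕ eval (var i) 0s    ≈⟨ +-cong (eval-const (lookup c i) 0s) (eval-var i 0s) ⟩
        lookup c i ⊕ lookup 0s i                          ≈⟨ +-congˡ (reflexive (VP.lookup-replicate i 0#)) ⟩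
        lookup c i ⊕ 0#                                   ≈⟨ +-identityʳ _ ⟩
        lookup c i                                        ∎

  ≈const+dropMonomial-0ᵥ : ∀ {m} (X : Poly m) → X ≈ₚ (const (coeff X 0ᵥ) +ₚ dropMonomial 0ᵥ X)
  ≈const+dropMonomial-0ᵥ {m} X = ⟪ (λ α → sym (trans (coeff-++ (const (coeff X 0ᵥ)) (dropMonomial 0ᵥ X) α)
    (trans (+-congʳ (coeff-const _ α)) (split α (≡-dec N._≟_ α 0ᵥ))))) ⟫
    where
      split : ∀ α → Dec (α ≡ 0ᵥ) → kron 0ᵥ α (coeff X 0ᵥ) ⊕ coeff (dropMonomial 0ᵥ X) α ≈ coeff X α
      split α (yes Eq.refl) = trans (+-cong (kron-≡ {β = 0ᵥ {m}} Eq.refl _) (coeff-dropMonomial-≡ 0ᵥ X)) (+-identityʳ _)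
      split α (no α≢0)      = trans (+-cong (kron-≢ {β = 0ᵥ} {α = α} _ (λ eq → α≢0 (Eq.sym eq)))
                                            (coeff-dropMonomial-≢ 0ᵥ α X α≢0)) (+-identityˡ _)

  order≥-dropMonomial-0ᵥ : ∀ {m} (X : Poly m) → Order≥ (dropMonomial 0ᵥ X) 1
  order≥-dropMonomial-0ᵥ X α ∣α∣<1 = Eq.subst (λ α → coeff (dropMonomial 0ᵥ X) α ≈ 0#)
    (Eq.sym (∣∣≡0⇒≡0ᵥ α (NP.n<1⇒n≡0 ∣α∣<1))) (coeff-dropMonomial-≡ 0ᵥ X)
    where
      ∣∣≡0⇒≡0ᵥ : ∀ {m} (α : Monomial m) → ∣ α ∣ₘ ≡ 0 → α ≡ 0ᵥ
      ∣∣≡0⇒≡0ᵥ V.[]       _  = Eq.refl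
      ∣∣≡0⇒≡0ᵥ (i V.∷ α) eq = Eq.cong₂ V._∷_ (NP.m+n≡0⇒m≡0 i eq) (∣∣≡0⇒≡0ᵥ α (NP.m+n≡0⇒n≡0 i eq))

  translate≈eval+dropMonomial-0ᵥ : ∀ {k} (b : Vec Carrier k) (s : Poly k) →
                                   translate b s ≈ₚ (const (eval s b) +ₚ dropMonomial 0ᵥ (translate b s))
  translate≈eval+dropMonomial-0ᵥ b s = ≈ₚ-trans (≈const+dropMonomial-0ᵥ (translate b s))
    (+ₚ-cong (const-cong (coeff-0ᵥ-translate b s)) (≈ₚ-refl {p = dropMonomial 0ᵥ (translate b s)}))

  -- Composition does not lower multiplicity: after moving b to the origin, each σᵢ is its value
  -- at b plus a polynomial without constant term.
  order≥-translate-subst : ∀ {m k} (Q : Poly m) (σ : Vec (Poly k) m) b M →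
    Order≥ (translate (map (λ s → eval s b) σ) Q) M → Order≥ (translate b (subst Q σ)) M
  order≥-translate-subst Q σ b M Q-ord = order≥-cong (≈ₚ-sym composition)
    (order≥-subst (translate σb Q) ψ M ψ-order Q-ord)
    where
      σb = map (λ s → eval s b) σ
      ψ = map (λ s → dropMonomial 0ᵥ (translate b s)) σ
      ψ-order : ∀ i → Order≥ (lookup ψ i) 1
      ψ-order i = Eq.subst (λ q → Order≥ q 1) (Eq.sym (VP.lookup-map i _ σ))
        (order≥-dropMonomial-0ᵥ (translate b (lookup σ i)))
      pointwise : ∀ i → lookup (map (translate b) σ) i ≈ₚ lookup (zipWith _+ₚ_ (map const σb) ψ) i
      pointwise i = begin
        lookup (map (translate b) σ) i          ≡⟨ VP.lookup-map i (translate b) σ ⟩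
        translate b (lookup σ i)                ≈⟨ translate≈eval+dropMonomial-0ᵥ b (lookup σ i) ⟩
        const (eval (lookup σ i) b) +ₚ dropMonomial 0ᵥ (translate b (lookup σ i))
          ≡⟨ Eq.cong₂ _+ₚ_ (Eq.trans (VP.lookup-map i const σb) (Eq.cong const (VP.lookup-map i (λ s → eval s b) σ)))
                           (VP.lookup-map i _ σ) ⟨
        lookup (map const σb) i +ₚ lookup ψ i   ≡⟨ VP.lookup-zipWith _+ₚ_ i (map const σb) ψ ⟨
        lookup (zipWith _+ₚ_ (map const σb) ψ) i ∎
        where open ≈ₚ-Reasoning
      composition : translate b (subst Q σ) ≈ₚ subst (translate σb Q) ψ
      composition = begin
        subst (subst Q σ) (translation b)          ≈⟨ subst-subst Q σ (translation b) ⟩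
        subst Q (map (translate b) σ)              ≈⟨ subst-congʳ Q {map (translate b) σ} {zipWith _+ₚ_ (map const σb) ψ} pointwise ⟩
        subst Q (zipWith _+ₚ_ (map const σb) ψ)    ≈⟨ subst-translate σb Q ψ ⟨
        subst (translate σb Q) ψ                   ∎
        where open ≈ₚ-Reasoning

  -- Univariate polynomials

  [_]₁ : ∀ {a} {A : Set a} → A → Vec A 1
  [ x ]₁ = x V.∷ V.[]

  X : Poly 1
  X = var Fn.zero

  [_]₁-injective : ∀ {i j : ℕ} → [ i ]₁ ≡ [ j ]₁ → i ≡ j
  [_]₁-injective Eq.refl = Eq.refl

  X^ₚ≈mono : ∀ r → (X ^ₚ r) ≈ₚ mono [ r ]₁
  X^ₚ≈mono r = ≈ₚ-trans (^ₚ-cong (var-≈ Fn.zero) r)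
    (≈ₚ-trans (mono-^ₚ [ 1 ]₁ r) (≈ₚ-reflexive (Eq.cong (λ i → mono [ i ]₁) (NP.*-identityʳ r))))

  coeff-X^-*ₚ : ∀ (V : Poly 1) r i → coeff (mono [ r ]₁ *ₚ V) [ i ]₁ ≈ ∑ V (λ u → kron ([ r ]₁ +ᵥ proj₁ u) [ i ]₁ (proj₂ u))
  coeff-X^-*ₚ V r i = trans (coeff-*ₚ (mono [ r ]₁) V [ i ]₁)
    (trans (+-identityʳ _) (∑-cong V (λ u → kron-cong {β = [ r ]₁ +ᵥ proj₁ u} {α = [ i ]₁} Eq.refl (*-identityˡ _))))

  coeff-X^-*ₚ-≥ : ∀ (V : Poly 1) r i → r ≤ i → coeff (mono [ r ]₁ *ₚ V) [ i ]₁ ≈ coeff V [ i N.∸ r ]₁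
  coeff-X^-*ₚ-≥ V r i r≤i = trans (coeff-X^-*ₚ V r i) (trans (∑-cong V reindex) (sym (coeff≈∑ V [ i N.∸ r ]₁)))
    where
      reindex : ∀ (u : Monomial 1 × Carrier) → kron ([ r ]₁ +ᵥ proj₁ u) [ i ]₁ (proj₂ u) ≈ kron (proj₁ u) [ i N.∸ r ]₁ (proj₂ u)
      reindex ((j V.∷ V.[]) , b) with ≡-dec N._≟_ [ r + j ]₁ [ i ]₁ | ≡-dec N._≟_ [ j ]₁ [ i N.∸ r ]₁
      ... | yes _    | yes _    = refl
      ... | no  _    | no  _    = refl
      ... | yes r+j≡i | no j≢i-r = ⊥-elim (j≢i-r (Eq.cong [_]₁
                                     (Eq.trans (Eq.sym (NP.m+n∸m≡n r j)) (Eq.cong (N._∸ r) ([_]₁-injective r+j≡i)))))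
      ... | no r+j≢i | yes j≡i-r = ⊥-elim (r+j≢i (Eq.cong [_]₁
                                     (Eq.trans (Eq.cong (r +_) ([_]₁-injective j≡i-r)) (NP.m+[n∸m]≡n r≤i))))

  coeff-X^-*ₚ-< : ∀ (V : Poly 1) r i → i < r → coeff (mono [ r ]₁ *ₚ V) [ i ]₁ ≈ 0#
  coeff-X^-*ₚ-< V r i i<r = trans (coeff-X^-*ₚ V r i) (∑-zero V below)
    where
      below : ∀ (u : Monomial 1 × Carrier) → kron ([ r ]₁ +ᵥ proj₁ u) [ i ]₁ (proj₂ u) ≈ 0#
      below ((j V.∷ V.[]) , b) = kron-≢ {β = [ r + j ]₁} {α = [ i ]₁} b
        (λ eq → NP.<⇒≱ i<r (Eq.subst (r ≤_) ([_]₁-injective eq) (NP.m≤m+n r j)))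

  lowerTerm : ℕ → Monomial 1 × Carrier → Poly 1
  lowerTerm r ((i V.∷ V.[]) , b) with r N.≤? i
  ... | yes _ = ([ i N.∸ r ]₁ , b) ∷ []
  ... | no  _ = []

  -- H ÷X^ r has coefficients j ↦ coeff H [ j + r ]: it is the quotient when X^r divides H
  _÷X^_ : Poly 1 → ℕ → Poly 1
  H ÷X^ r = L.concatMap (lowerTerm r) H

  coeff-÷X^ : ∀ (H : Poly 1) r j → coeff (H ÷X^ r) [ j ]₁ ≈ coeff H [ j + r ]₁
  coeff-÷X^ H r j = trans (coeff-concatMap H (lowerTerm r) [ j ]₁) (trans (∑-cong H term) (sym (coeff≈∑ H [ j + r ]₁)))
    where
      term : ∀ t → coeff (lowerTerm r t) [ j ]₁ ≈ kron (proj₁ t) [ j + r ]₁ (proj₂ t)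
      term ((i V.∷ V.[]) , b) with r N.≤? i
      ... | no r≰i = sym (kron-≢ {β = [ i ]₁} {α = [ j + r ]₁} b
                          (λ eq → r≰i (Eq.subst (r ≤_) (Eq.sym ([_]₁-injective eq)) (NP.m≤n+m r j))))
      ... | yes r≤i with ≡-dec N._≟_ [ i N.∸ r ]₁ [ j ]₁ | ≡-dec N._≟_ [ i ]₁ [ j + r ]₁
      ...   | yes _ | yes _ = +-identityʳ _
      ...   | no  _ | no  _ = refl
      ...   | yes i-r≡j | no i≢j+r = ⊥-elim (i≢j+r (Eq.cong [_]₁
                                       (Eq.trans (Eq.sym (NP.m∸n+n≡m r≤i)) (Eq.cong (_+ r) ([_]₁-injective i-r≡j)))))
      ...   | no i-r≢j | yes i≡j+r = ⊥-elim (i-r≢j (Eq.cong [_]₁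
                                       (Eq.trans (Eq.cong (N._∸ r) ([_]₁-injective i≡j+r)) (NP.m+n∸n≡m j r))))

  ≈X^*ₚ÷X^ : ∀ (H : Poly 1) r → Order≥ H r → H ≈ₚ ((X ^ₚ r) *ₚ (H ÷X^ r))
  ≈X^*ₚ÷X^ H r H-ord = ≈ₚ-trans ⟪ at-i ⟫ (*ₚ-congʳ (H ÷X^ r) (≈ₚ-sym (X^ₚ≈mono r)))
    where
      at-i : ∀ α → coeff H α ≈ coeff (mono [ r ]₁ *ₚ (H ÷X^ r)) α
      at-i (i V.∷ V.[]) with r N.≤? i
      ... | yes r≤i = sym (trans (coeff-X^-*ₚ-≥ (H ÷X^ r) r i r≤i)
                        (trans (coeff-÷X^ H r (i N.∸ r)) (reflexive (Eq.cong (λ j → coeff H [ j ]₁) (NP.m∸n+n≡m r≤i)))))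
      ... | no r≰i  = trans (H-ord [ i ]₁ (Eq.subst (_< r) (Eq.sym (NP.+-identityʳ i)) (NP.≰⇒> r≰i)))
                            (sym (coeff-X^-*ₚ-< (H ÷X^ r) r i (NP.≰⇒> r≰i)))

  degree≤-÷X^ : ∀ (H : Poly 1) r D → Degree≤ H D → Degree≤ (H ÷X^ r) (D N.∸ r)
  degree≤-÷X^ H r D H-deg (j V.∷ V.[]) <∣j∣ = trans (coeff-÷X^ H r j)
    (H-deg [ j + r ]₁ (Eq.subst (D <_) (Eq.sym (NP.+-identityʳ (j + r)))
      (m∸n<o⇒m<o+n (Eq.subst (D N.∸ r <_) (NP.+-identityʳ j) <∣j∣))))

  -- Slices along the first variable

  sliceTerm : ∀ {d} → ℕ → Monomial (N.suc d) × Carrier → Poly d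
  sliceTerm j ((i V.∷ γ) , b) with j N.≟ i
  ... | yes _ = (γ , b) ∷ []
  ... | no  _ = []

  slice : ∀ {d} → Poly (N.suc d) → ℕ → Poly d
  slice P j = L.concatMap (sliceTerm j) P

  coeff-slice : ∀ {d} (P : Poly (N.suc d)) j γ → coeff (slice P j) γ ≈ coeff P (j V.∷ γ)
  coeff-slice P j γ = trans (coeff-concatMap P (sliceTerm j) γ)
    (trans (∑-cong P term) (sym (coeff≈∑ P (j V.∷ γ))))
    where
      term : ∀ t → coeff (sliceTerm j t) γ ≈ kron (proj₁ t) (j V.∷ γ) (proj₂ t)
      term ((i V.∷ γ′) , b) with j N.≟ i
      ... | yes Eq.refl = trans (coeff-singleton γ′ b γ) (kron-∷ j γ′ γ b)
      ... | no j≢i      = sym (kron-≢ {β = i V.∷ γ′} {α = j V.∷ γ} b (λ eq → j≢i (Eq.sym (VP.∷-injectiveˡ eq))))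

  translation-∷ : ∀ {d} x (a′ : Vec Carrier d) →
    translation (x V.∷ a′) ≈ᵥ (liftˡ {1} {d} (const x +ₚ X) V.∷ map (liftʳ {1} {d}) (translation a′))
  translation-∷ {d} x a′ Fn.zero = ≈ₚ-sym (≈ₚ-trans (≈ₚ-reflexive (Liftˡ.rename-+ₚ {1} {d} (const x) X))
    (+ₚ-cong (≈ₚ-reflexive (Liftˡ.rename-const {1} {d} x)) (Liftˡ.rename-var {1} {d} Fn.zero Fn.zero Eq.refl)))
  translation-∷ {d} x a′ (Fn.suc i) = begin
    lookup (translation (x V.∷ a′)) (Fn.suc i)     ≡⟨ lookup-translation (x V.∷ a′) (Fn.suc i) ⟩
    const (lookup a′ i) +ₚ var (Fn.suc i)           ≈⟨ +ₚ-cong (≈ₚ-reflexive (Liftʳ.rename-const {1} {d} (lookup a′ i)))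
                                                               (Liftʳ.rename-var {1} {d} i (Fn.suc i) Eq.refl) ⟨
    liftʳ {1} (const (lookup a′ i)) +ₚ liftʳ {1} (var i) ≡⟨ Liftʳ.rename-+ₚ {1} {d} (const (lookup a′ i)) (var i) ⟨
    liftʳ {1} (const (lookup a′ i) +ₚ var i)        ≡⟨ Eq.cong (liftʳ {1}) (lookup-translation a′ i) ⟨
    liftʳ {1} (lookup (translation a′) i)           ≡⟨ VP.lookup-map i (liftʳ {1} {d}) (translation a′) ⟨
    lookup (map (liftʳ {1} {d}) (translation a′)) i ∎
    where open ≈ₚ-Reasoning

  coeff-powₚ-translation-∷ : ∀ {d} x (a′ : Vec Carrier d) j δ′ i γ →
    coeff (powₚ (translation (x V.∷ a′)) (j V.∷ δ′)) (i V.∷ γ) ≈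
    coeff ((const x +ₚ X) ^ₚ j) [ i ]₁ * coeff (powₚ (translation a′) δ′) γ
  coeff-powₚ-translation-∷ {d} x a′ j δ′ i γ = begin
    coeff (powₚ (translation (x V.∷ a′)) (j V.∷ δ′)) (i V.∷ γ)
      ≈⟨ at (powₚ-cong {σ = translation (x V.∷ a′)} {τ = liftˡ {1} {d} (const x +ₚ X) V.∷ map (liftʳ {1} {d}) (translation a′)}
                       (translation-∷ x a′) (j V.∷ δ′)) (i V.∷ γ) ⟩
    coeff ((liftˡ {1} {d} (const x +ₚ X) ^ₚ j) *ₚ powₚ (map (liftʳ {1} {d}) (translation a′)) δ′) (i V.∷ γ)
      ≈⟨ at (*ₚ-cong (≈ₚ-sym (Liftˡ.rename-^ₚ {1} {d} (const x +ₚ X) j)) (Liftʳ.powₚ-rename {1} {d} (translation a′) δ′)) (i V.∷ γ) ⟩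
    coeff (liftˡ {1} {d} ((const x +ₚ X) ^ₚ j) *ₚ liftʳ {1} (powₚ (translation a′) δ′)) ([ i ]₁ ++ γ)
      ≈⟨ coeff-liftˡ-*ₚ-liftʳ {1} {d} ((const x +ₚ X) ^ₚ j) (powₚ (translation a′) δ′) [ i ]₁ γ ⟩
    coeff ((const x +ₚ X) ^ₚ j) [ i ]₁ * coeff (powₚ (translation a′) δ′) γ ∎
    where open ≈-Reasoning

  fiberPoly : ∀ {d} → Vec Carrier d → Monomial d → Poly (N.suc d) → Poly 1
  fiberPoly a′ γ P =
    L.map (λ t → [ V.head (proj₁ t) ]₁ , proj₂ t * coeff (powₚ (translation a′) (V.tail (proj₁ t))) γ) P

  coeff-fiberPoly : ∀ {d} (a′ : Vec Carrier d) γ (P : Poly (N.suc d)) j →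
                    coeff (fiberPoly a′ γ P) [ j ]₁ ≈ coeff (translate a′ (slice P j)) γ
  coeff-fiberPoly a′ γ P j = begin
    coeff (fiberPoly a′ γ P) [ j ]₁                          ≈⟨ trans (coeff≈∑ (fiberPoly a′ γ P) [ j ]₁) (∑-map P _ _) ⟩
    ∑ P (λ t → kron [ V.head (proj₁ t) ]₁ [ j ]₁ _)          ≈⟨ ∑-cong P term ⟨
    ∑ P (λ t → ⟨ sliceTerm j t , (λ β → coeff (powₚ (translation a′) β) γ) ⟩)
                                                             ≈⟨ ∑-concatMap P (sliceTerm j) _ ⟨
    ⟨ slice P j , (λ β → coeff (powₚ (translation a′) β) γ) ⟩ ≈⟨ coeff-subst (slice P j) (translation a′) γ ⟨
    coeff (translate a′ (slice P j)) γ                       ∎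
    where
      open ≈-Reasoning
      term : ∀ (t : Monomial (N.suc _) × Carrier) → ⟨ sliceTerm j t , (λ β → coeff (powₚ (translation a′) β) γ) ⟩ ≈
               kron [ V.head (proj₁ t) ]₁ [ j ]₁ (proj₂ t * coeff (powₚ (translation a′) (V.tail (proj₁ t))) γ)
      term ((i V.∷ δ′) , b) with j N.≟ i
      ... | yes Eq.refl = trans (+-identityʳ _) (sym (kron-≡ {β = [ j ]₁} Eq.refl _))
      ... | no j≢i      = sym (kron-≢ {β = [ i ]₁} {α = [ j ]₁} _ (λ eq → j≢i (Eq.sym ([_]₁-injective eq))))

  coeff-translate-fiberPoly : ∀ {d} x (a′ : Vec Carrier d) γ (P : Poly (N.suc d)) i →
    coeff (translate [ x ]₁ (fiberPoly a′ γ P)) [ i ]₁ ≈ coeff (translate (x V.∷ a′) P) (i V.∷ γ)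
  coeff-translate-fiberPoly x a′ γ P i = begin
    coeff (translate [ x ]₁ (fiberPoly a′ γ P)) [ i ]₁       ≈⟨ trans (coeff-subst (fiberPoly a′ γ P) (translation [ x ]₁) [ i ]₁)
                                                                       (∑-map P _ _) ⟩
    ∑ P (λ t → _ * coeff (powₚ (translation [ x ]₁) [ V.head (proj₁ t) ]₁) [ i ]₁)
                                                             ≈⟨ ∑-cong P term ⟨
    ⟨ P , (λ β → coeff (powₚ (translation (x V.∷ a′)) β) (i V.∷ γ)) ⟩ ≈⟨ coeff-subst P (translation (x V.∷ a′)) (i V.∷ γ) ⟨
    coeff (translate (x V.∷ a′) P) (i V.∷ γ)                 ∎
    where
      open ≈-Reasoning
      term : ∀ (t : Monomial (N.suc _) × Carrier) →
             proj₂ t * coeff (powₚ (translation (x V.∷ a′)) (proj₁ t)) (i V.∷ γ) ≈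
             (proj₂ t * coeff (powₚ (translation a′) (V.tail (proj₁ t))) γ) *
               coeff (powₚ (translation [ x ]₁) [ V.head (proj₁ t) ]₁) [ i ]₁
      term ((j V.∷ δ′) , b) = begin
        b * coeff (powₚ (translation (x V.∷ a′)) (j V.∷ δ′)) (i V.∷ γ)     ≈⟨ *-congˡ (coeff-powₚ-translation-∷ x a′ j δ′ i γ) ⟩
        b * (coeff ((const x +ₚ X) ^ₚ j) [ i ]₁ * coeff (powₚ (translation a′) δ′) γ)
                                                                           ≈⟨ *-congˡ (*-comm _ _) ⟩
        b * (coeff (powₚ (translation a′) δ′) γ * coeff ((const x +ₚ X) ^ₚ j) [ i ]₁)
                                                                           ≈⟨ *-assoc _ _ _ ⟨
        (b * coeff (powₚ (translation a′) δ′) γ) * coeff ((const x +ₚ X) ^ₚ j) [ i ]₁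
                                                                           ≈⟨ *-congˡ (at powₚ-[x] [ i ]₁) ⟨
        (b * coeff (powₚ (translation a′) δ′) γ) * coeff (powₚ (translation [ x ]₁) [ j ]₁) [ i ]₁ ∎
        where
          powₚ-[x] : powₚ (translation [ x ]₁) [ j ]₁ ≈ₚ ((const x +ₚ X) ^ₚ j)
          powₚ-[x] = ≈ₚ-trans (*ₚ-comm ((const x +ₚ X) ^ₚ j) (const 1#)) (const-1#-*ₚ _)

  hasse-vanishes-above-degree : ∀ {m} (F : Poly m) D (β : Monomial m) → Degree≤ F D → D < ∣ β ∣ₘ → hasse F β ≈ₚ []
  hasse-vanishes-above-degree F D β F-deg D<∣β∣ = ⟪ (λ α → coeff-hasse-vanishes F β α (λ β′ eq →
    F-deg β′ (Eq.subst (D <_) (Eq.sym eq) (NP.<-≤-trans D<∣β∣ (NP.m≤n+m ∣ β ∣ₘ ∣ α ∣ₘ))))) ⟫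

  curve : ∀ {d e} → Vec Carrier (d + e) → Vec Carrier e → Vec (Poly d) e → Vec (Poly d) (d + e)
  curve a ρ g = zipWith _+ₚ_ (map const a) (tabulate var ++ zipWith (λ r gi → const r *ₚ gi) ρ g)

  curvePoint : ∀ {d e} → Vec Carrier (d + e) → Vec Carrier e → Vec (Poly d) e → Vec Carrier d → Vec Carrier (d + e)
  curvePoint a ρ g t = zipWith _⊕_ a (t ++ zipWith (λ r gi → r * eval gi t) ρ g)

  lookup-curve : ∀ {d e} (a : Vec Carrier (d + e)) ρ (g : Vec (Poly d) e) i →
    lookup (curve a ρ g) i ≡ const (lookup a i) +ₚ lookup (tabulate var ++ zipWith (λ r gi → const r *ₚ gi) ρ g) i
  lookup-curve a ρ g i = Eq.trans (VP.lookup-zipWith _+ₚ_ i (map const a) _) (Eq.cong (_+ₚ _) (VP.lookup-map i const a))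

  degree≤-curve : ∀ {d e} (a : Vec Carrier (d + e)) ρ (g : Vec (Poly d) e) l → 1 ≤ l →
    (∀ j → Degree≤ (lookup g j) l) → ∀ i → Degree≤ (lookup (curve a ρ g) i) l
  degree≤-curve a ρ g l 1≤l g-deg i = Eq.subst (λ q → Degree≤ q l) (Eq.sym (lookup-curve a ρ g i))
    (degree≤-+ₚ (const (lookup a i)) _ (degree≤-mono (const (lookup a i)) N.z≤n (degree≤-const (lookup a i)))
      (lookup-++-pointwise (λ p _ → Degree≤ p l) (tabulate var) (tabulate var) ρg ρg var-deg ρg-deg i))
    where
      ρg = zipWith (λ r gi → const r *ₚ gi) ρ g
      var-deg : ∀ j → Degree≤ (lookup (tabulate var) j) l
      var-deg j = Eq.subst (λ q → Degree≤ q l) (Eq.sym (VP.lookup∘tabulate var j))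
        (degree≤-mono (var j) 1≤l (degree≤-var j))
      ρg-deg : ∀ j → Degree≤ (lookup ρg j) l
      ρg-deg j = Eq.subst (λ q → Degree≤ q l) (Eq.sym (VP.lookup-zipWith (λ r gi → const r *ₚ gi) j ρ g))
        (degree≤-*ₚ (const (lookup ρ j)) (lookup g j) 0 l (degree≤-const (lookup ρ j)) (g-deg j))

  eval-curve : ∀ {d e} (a : Vec Carrier (d + e)) ρ (g : Vec (Poly d) e) t i →
               eval (lookup (curve a ρ g) i) t ≈ lookup (curvePoint a ρ g t) i
  eval-curve a ρ g t i = begin
    eval (lookup (curve a ρ g) i) t
      ≡⟨ Eq.cong (λ q → eval q t) (lookup-curve a ρ g i) ⟩
    eval (const (lookup a i) +ₚ lookup (tabulate var ++ ρg) i) t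
      ≈⟨ trans (eval-+ₚ (const (lookup a i)) (lookup (tabulate var ++ ρg) i) t) (+-congʳ (eval-const (lookup a i) t)) ⟩
    lookup a i ⊕ eval (lookup (tabulate var ++ ρg) i) t
      ≈⟨ +-congˡ (lookup-++-pointwise (λ p x → eval p t ≈ x) (tabulate var) t ρg _ var-eval ρg-eval i) ⟩
    lookup a i ⊕ lookup (t ++ zipWith (λ r gi → r * eval gi t) ρ g) i
      ≡⟨ VP.lookup-zipWith _⊕_ i a _ ⟨
    lookup (curvePoint a ρ g t) i ∎
    where
      open ≈-Reasoning
      ρg = zipWith (λ r gi → const r *ₚ gi) ρ g
      var-eval : ∀ j → eval (lookup (tabulate var) j) t ≈ lookup t j
      var-eval j = trans (reflexive (Eq.cong (λ q → eval q t) (VP.lookup∘tabulate var j))) (eval-var j t)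
      ρg-eval : ∀ j → eval (lookup ρg j) t ≈ lookup (zipWith (λ r gi → r * eval gi t) ρ g) j
      ρg-eval j = begin
        eval (lookup ρg j) t                                   ≡⟨ Eq.cong (λ q → eval q t) (VP.lookup-zipWith (λ r gi → const r *ₚ gi) j ρ g) ⟩
        eval (const (lookup ρ j) *ₚ lookup g j) t              ≈⟨ eval-*ₚ (const (lookup ρ j)) (lookup g j) t ⟩
        eval (const (lookup ρ j)) t * eval (lookup g j) t      ≈⟨ *-congʳ (eval-const (lookup ρ j) t) ⟩
        lookup ρ j * eval (lookup g j) t                       ≡⟨ VP.lookup-zipWith (λ r gi → r * eval gi t) j ρ g ⟨
        lookup (zipWith (λ r gi → r * eval gi t) ρ g) j        ∎

  multAtLeast-curve : ∀ {d e} (f : Poly (d + e)) a ρ (g : Vec (Poly d) e) t M →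
    MultAtLeast f (curvePoint a ρ g t) M → MultAtLeast f (map (λ s → eval s t) (curve a ρ g)) M
  multAtLeast-curve f a ρ g t M f-mult β ∣β∣<M =
    trans (eval-congʳ (hasse f β) {map (λ s → eval s t) (curve a ρ g)} {curvePoint a ρ g t} pointwise) (f-mult β ∣β∣<M)
    where
      pointwise : ∀ i → lookup (map (λ s → eval s t) (curve a ρ g)) i ≈ lookup (curvePoint a ρ g t) i
      pointwise i = trans (reflexive (VP.lookup-map i (λ s → eval s t) (curve a ρ g))) (eval-curve a ρ g t i)

module RootBounds {c ℓ} (R : CommutativeRing c ℓ) (*-cancelˡ-nonZero :
    AlmostLeftCancellative (CommutativeRing._≈_ R) (CommutativeRing.0# R) (CommutativeRing._*_ R)) where
  open CommutativeRing R renaming (_+_ to _⊕_) hiding (zero)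
  open Polynomials R
  open PolynomialAlgebra R

  *-eliminateˡ : ∀ {x y} → ¬ x ≈ 0# → x * y ≈ 0# → y ≈ 0#
  *-eliminateˡ {x} {y} x≉0 xy≈0 = *-cancelˡ-nonZero x y 0# x≉0 (trans xy≈0 (sym (zeroʳ x)))

  -- A nonzero constant term makes c + X a unit for the order at 0: compare coefficients upwards.
  order≥-cancel-linear : ∀ {c} → ¬ c ≈ 0# → ∀ s (W : Poly 1) → Order≥ ((const c +ₚ X) *ₚ W) s → Order≥ W s
  order≥-cancel-linear {c} c≉0 s W cW-ord (i V.∷ V.[]) i<s = W-vanishes i (Eq.subst (_< s) (NP.+-identityʳ i) i<s)
    where
      coeff-cW : ∀ i → coeff ((const c +ₚ X) *ₚ W) [ i ]₁ ≈ c * coeff W [ i ]₁ ⊕ coeff (mono [ 1 ]₁ *ₚ W) [ i ]₁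
      coeff-cW i = trans (at (*ₚ-distribʳ (const c) X W) [ i ]₁) (trans (coeff-++ (const c *ₚ W) (X *ₚ W) [ i ]₁)
        (+-cong (const-*ₚ c W [ i ]₁) (at (*ₚ-congʳ W (var-≈ Fn.zero)) [ i ]₁)))
      cW-vanishes : ∀ i → i < s → c * coeff W [ i ]₁ ⊕ coeff (mono [ 1 ]₁ *ₚ W) [ i ]₁ ≈ 0#
      cW-vanishes i i<s = trans (sym (coeff-cW i)) (cW-ord [ i ]₁ (Eq.subst (_< s) (Eq.sym (NP.+-identityʳ i)) i<s))
      W-vanishes : ∀ i → i < s → coeff W [ i ]₁ ≈ 0#
      W-vanishes N.zero    0<s = *-eliminateˡ c≉0 (begin
        c * coeff W [ 0 ]₁                                  ≈⟨ +-identityʳ _ ⟨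
        c * coeff W [ 0 ]₁ ⊕ 0#                             ≈⟨ +-congˡ (coeff-X^-*ₚ-< W 1 0 (N.s≤s N.z≤n)) ⟨
        c * coeff W [ 0 ]₁ ⊕ coeff (mono [ 1 ]₁ *ₚ W) [ 0 ]₁ ≈⟨ cW-vanishes 0 0<s ⟩
        0#                                                  ∎)
        where open ≈-Reasoning
      W-vanishes (N.suc i) i+1<s = *-eliminateˡ c≉0 (begin
        c * coeff W [ N.suc i ]₁                                  ≈⟨ +-identityʳ _ ⟨
        c * coeff W [ N.suc i ]₁ ⊕ 0#                             ≈⟨ +-congˡ (W-vanishes i (NP.<-trans (NP.n<1+n i) i+1<s)) ⟨
        c * coeff W [ N.suc i ]₁ ⊕ coeff W [ i ]₁                 ≈⟨ +-congˡ (coeff-X^-*ₚ-≥ W 1 (N.suc i) (N.s≤s N.z≤n)) ⟨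
        c * coeff W [ N.suc i ]₁ ⊕ coeff (mono [ 1 ]₁ *ₚ W) [ N.suc i ]₁ ≈⟨ cW-vanishes (N.suc i) i+1<s ⟩
        0#                                                        ∎)
        where open ≈-Reasoning

  order≥-cancel-linear^ : ∀ {c} → ¬ c ≈ 0# → ∀ r s (W : Poly 1) → Order≥ (((const c +ₚ X) ^ₚ r) *ₚ W) s → Order≥ W s
  order≥-cancel-linear^ c≉0 N.zero    s W ord = order≥-cong (const-1#-*ₚ W) ord
  order≥-cancel-linear^ {c} c≉0 (N.suc r) s W ord = order≥-cancel-linear^ c≉0 r s W
    (order≥-cancel-linear c≉0 s (((const c +ₚ X) ^ₚ r) *ₚ W)
      (order≥-cong (*ₚ-assoc (const c +ₚ X) ((const c +ₚ X) ^ₚ r) W) ord))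

  -- A root of multiplicity r at a splits off the factor (X - a)^r; here X - a is translate [ - a ]₁ X.
  factor-root : ∀ a (h : Poly 1) r → Order≥ (translate [ a ]₁ h) r →
    h ≈ₚ ((translate [ - a ]₁ X ^ₚ r) *ₚ translate [ - a ]₁ (translate [ a ]₁ h ÷X^ r))
  factor-root a h r h-ord = begin
    h                                          ≈⟨ translate-neg-translate [ a ]₁ h ⟨
    translate [ - a ]₁ H                       ≈⟨ subst-cong (translation [ - a ]₁) (≈X^*ₚ÷X^ H r h-ord) ⟩
    translate [ - a ]₁ ((X ^ₚ r) *ₚ (H ÷X^ r))  ≈⟨ subst-*ₚ (X ^ₚ r) (H ÷X^ r) (translation [ - a ]₁) ⟩
    translate [ - a ]₁ (X ^ₚ r) *ₚ translate [ - a ]₁ (H ÷X^ r)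
      ≈⟨ *ₚ-congʳ (translate [ - a ]₁ (H ÷X^ r)) (subst-^ₚ X (translation [ - a ]₁) r) ⟩
    (translate [ - a ]₁ X ^ₚ r) *ₚ translate [ - a ]₁ (H ÷X^ r) ∎
    where
      open ≈ₚ-Reasoning
      H = translate [ a ]₁ h

  -x⊕y≉0 : ∀ {x y} → ¬ x ≈ y → ¬ (- x ⊕ y) ≈ 0#
  -x⊕y≉0 {x} {y} x≉y -x⊕y≈0 = x≉y (begin
    x                  ≈⟨ +-identityʳ x ⟨
    x ⊕ 0#             ≈⟨ +-congˡ -x⊕y≈0 ⟨
    x ⊕ (- x ⊕ y)      ≈⟨ +-assoc x (- x) y ⟨
    (x ⊕ - x) ⊕ y      ≈⟨ +-congʳ (-‿inverseʳ x) ⟩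
    0# ⊕ y             ≈⟨ +-identityˡ y ⟩
    y                  ∎)
    where open ≈-Reasoning

  order≥-cofactor : ∀ {a b} → ¬ a ≈ b → ∀ (h q : Poly 1) r s →
    h ≈ₚ ((translate [ - a ]₁ X ^ₚ r) *ₚ q) → Order≥ (translate [ b ]₁ h) s → Order≥ (translate [ b ]₁ q) s
  order≥-cofactor {a} {b} a≉b h q r s h≈ h-ord =
    order≥-cancel-linear^ (-x⊕y≉0 a≉b) r s (translate [ b ]₁ q) (order≥-cong translated h-ord)
    where
      translated : translate [ b ]₁ h ≈ₚ (((const (- a ⊕ b) +ₚ X) ^ₚ r) *ₚ translate [ b ]₁ q)
      translated = begin
        translate [ b ]₁ h                                              ≈⟨ subst-cong (translation [ b ]₁) h≈ ⟩
        translate [ b ]₁ ((translate [ - a ]₁ X ^ₚ r) *ₚ q)              ≈⟨ subst-*ₚ (translate [ - a ]₁ X ^ₚ r) q (translation [ b ]₁) ⟩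
        translate [ b ]₁ (translate [ - a ]₁ X ^ₚ r) *ₚ translate [ b ]₁ q ≈⟨ *ₚ-congʳ (translate [ b ]₁ q)
                                                                               (subst-^ₚ (translate [ - a ]₁ X) (translation [ b ]₁) r) ⟩
        (translate [ b ]₁ (translate [ - a ]₁ X) ^ₚ r) *ₚ translate [ b ]₁ q
          ≈⟨ *ₚ-congʳ (translate [ b ]₁ q) (^ₚ-cong (≈ₚ-trans (translate-translate [ b ]₁ [ - a ]₁ X)
                                                              (subst-var Fn.zero (translation [ - a ⊕ b ]₁))) r) ⟩
        ((const (- a ⊕ b) +ₚ X) ^ₚ r) *ₚ translate [ b ]₁ q              ∎
        where open ≈ₚ-Reasoning

  Distinct : ∀ {k} → Vec Carrier k → Set _
  Distinct v = ∀ i j → lookup v i ≈ lookup v j → i ≡ j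

  -- Induction on the number of points, splitting off (X - a)^r at each.
  rootBound : ∀ {k} (v : Vec Carrier k) → Distinct v → ∀ (h : Poly 1) δ r →
    Degree≤ h δ → δ < k N.* r → (∀ i → Order≥ (translate [ lookup v i ]₁ h) r) → h ≈ₚ []
  rootBound V.[] _ h δ r _ () _
  rootBound {N.suc k} (a V.∷ v) distinct h δ r h-deg δ<kr h-ord with r N.≤? δ
  ... | no r≰δ = begin
    h                                        ≈⟨ translate-neg-translate [ a ]₁ h ⟨
    translate [ - a ]₁ (translate [ a ]₁ h)  ≈⟨ subst-cong (translation [ - a ]₁)
                                                  (order>degree⇒≈[] (translate [ a ]₁ h) (degree≤-translate [ a ]₁ h δ h-deg)
                                                                    (h-ord Fn.zero) (NP.≰⇒> r≰δ)) ⟩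
    []                                       ∎
    where open ≈ₚ-Reasoning
  ... | yes r≤δ = begin
    h                                        ≈⟨ factor-root a h r (h-ord Fn.zero) ⟩
    (translate [ - a ]₁ X ^ₚ r) *ₚ q         ≈⟨ *ₚ-congˡ (translate [ - a ]₁ X ^ₚ r) q≈[] ⟩
    (translate [ - a ]₁ X ^ₚ r) *ₚ []        ≈⟨ *ₚ-zeroʳ (translate [ - a ]₁ X ^ₚ r) ⟩
    []                                       ∎
    where
      open ≈ₚ-Reasoning
      q = translate [ - a ]₁ (translate [ a ]₁ h ÷X^ r)
      q-deg : Degree≤ q (δ N.∸ r)
      q-deg = degree≤-translate [ - a ]₁ (translate [ a ]₁ h ÷X^ r) (δ N.∸ r)
        (degree≤-÷X^ (translate [ a ]₁ h) r δ (degree≤-translate [ a ]₁ h δ h-deg))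
      δ-r<kr : δ N.∸ r < k N.* r
      δ-r<kr = Eq.subst (δ N.∸ r <_) (NP.m+n∸m≡n r (k N.* r)) (NP.∸-monoˡ-< δ<kr r≤δ)
      q-ord : ∀ i → Order≥ (translate [ lookup v i ]₁ q) r
      q-ord i = order≥-cofactor (λ a≈vᵢ → FnP.0≢1+n (distinct Fn.zero (Fn.suc i) a≈vᵢ)) h q r r
        (factor-root a h r (h-ord Fn.zero)) (h-ord (Fn.suc i))
      q≈[] : q ≈ₚ []
      q≈[] = rootBound v (λ i j vᵢ≈vⱼ → FnP.suc-injective (distinct (Fn.suc i) (Fn.suc j) vᵢ≈vⱼ))
        q (δ N.∸ r) r q-deg δ-r<kr q-ord

  module Grid {k} (v : Vec Carrier k) (distinct : Distinct v) where

    gridPoint : ∀ {d} → Vec (Fin k) d → Vec Carrier d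
    gridPoint = map (lookup v)

    -- If the slices above t vanish, then for each γ the fiber polynomial has degree ≤ t and
    -- multiplicity M - |γ| at all k points of v, so it vanishes when t < k(M - |γ|).
    order≥-slice : ∀ {d} (P : Poly (N.suc d)) M t u → t < N.suc u N.* k →
      (∀ j → t < j → slice P j ≈ₚ []) → (∀ ι → Order≥ (translate (gridPoint ι) P) M) →
      ∀ ι′ → Order≥ (translate (gridPoint ι′) (slice P t)) (M N.∸ u)
    order≥-slice P M t u t<[u+1]k above P-ord ι′ γ ∣γ∣<M-u = begin
      coeff (translate a′ (slice P t)) γ ≈⟨ coeff-fiberPoly a′ γ P t ⟨
      coeff h [ t ]₁                     ≈⟨ at h≈[] [ t ]₁ ⟩
      0#                                 ∎
      where
        open ≈-Reasoning
        a′ = gridPoint ι′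
        h = fiberPoly a′ γ P
        r = M N.∸ ∣ γ ∣ₘ
        h-deg : Degree≤ h t
        h-deg (j V.∷ V.[]) t<∣j∣ = trans (coeff-fiberPoly a′ γ P j)
          (at (subst-cong (translation a′) (above j (Eq.subst (t <_) (NP.+-identityʳ j) t<∣j∣))) γ)
        u+1≤r : N.suc u ≤ r
        u+1≤r = NP.m+n≤o⇒m≤o∸n (N.suc u) (Eq.subst (_≤ M) (Eq.cong N.suc (NP.+-comm ∣ γ ∣ₘ u)) (m<o∸n⇒m+n<o ∣γ∣<M-u))
        t<kr : t < k N.* r
        t<kr = NP.<-≤-trans t<[u+1]k (Eq.subst (N.suc u N.* k ≤_) (NP.*-comm r k) (NP.*-monoˡ-≤ k u+1≤r))
        h-ord : ∀ i → Order≥ (translate [ lookup v i ]₁ h) r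
        h-ord i (i′ V.∷ V.[]) ∣i′∣<r = trans (coeff-translate-fiberPoly (lookup v i) a′ γ P i′)
          (P-ord (i V.∷ ι′) (i′ V.∷ γ) (m<o∸n⇒m+n<o (Eq.subst (_< r) (NP.+-identityʳ i′) ∣i′∣<r)))
        h≈[] : h ≈ₚ []
        h≈[] = rootBound v distinct h t r h-deg t<kr h-ord

    -- Schwartz–Zippel with multiplicities on the grid v^d: the slices P_j of P along x₁ are
    -- shown to vanish from the top down.
    schwartzZippel : ∀ d (P : Poly d) M δ → Degree≤ P δ → δ < M N.* k →
      (∀ ι → Order≥ (translate (gridPoint ι) P) M) → P ≈ₚ []
    schwartzZippel N.zero P N.zero δ P-deg () P-ord
    schwartzZippel N.zero P (N.suc M) δ P-deg δ<Mk P-ord = ⟪ (λ { V.[] →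
      trans (sym (at (translate-0# P) V.[])) (P-ord V.[] V.[] (N.s≤s N.z≤n)) }) ⟫
    schwartzZippel (N.suc d) P M δ P-deg δ<Mk P-ord = ⟪ (λ { (j V.∷ γ) →
      trans (sym (coeff-slice P j γ)) (at (from-top (N.suc δ) j δ<j+δ+1) γ) }) ⟫
      where
        slice-deg : ∀ t → Degree≤ (slice P t) (δ N.∸ t)
        slice-deg t γ <∣γ∣ = trans (coeff-slice P t γ)
          (P-deg (t V.∷ γ) (Eq.subst (δ <_) (NP.+-comm ∣ γ ∣ₘ t) (m∸n<o⇒m<o+n <∣γ∣)))
        slice-high : ∀ j → δ < j → slice P j ≈ₚ []
        slice-high j δ<j = ⟪ (λ γ → trans (coeff-slice P j γ)
          (P-deg (j V.∷ γ) (NP.<-≤-trans δ<j (NP.m≤m+n j ∣ γ ∣ₘ)))) ⟫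
        0<k : 0 < k
        0<k = NP.n≢0⇒n>0 (λ k≡0 → NP.n≮0 (Eq.subst (δ <_) (Eq.trans (Eq.cong (M N.*_) k≡0) (NP.*-zeroʳ M)) δ<Mk))
        slice-step : ∀ t → (∀ j → t < j → slice P j ≈ₚ []) → slice P t ≈ₚ []
        slice-step t above with t N.≤? δ | quotient-bounds t k 0<k
        ... | no t≰δ  | _ = slice-high t (NP.≰⇒> t≰δ)
        ... | yes t≤δ | (u , uk≤t , t<[u+1]k) = schwartzZippel d (slice P t) (M N.∸ u) (δ N.∸ t) (slice-deg t)
          δ-t<[M-u]k (order≥-slice P M t u t<[u+1]k above P-ord)
          where
            δ-t<[M-u]k : δ N.∸ t < (M N.∸ u) N.* k
            δ-t<[M-u]k = Eq.subst (δ N.∸ t <_) (Eq.sym (NP.*-distribʳ-∸ k M u))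
              (NP.≤-<-trans (NP.∸-monoʳ-≤ δ uk≤t) (NP.∸-monoˡ-< δ<Mk (NP.≤-trans uk≤t t≤δ)))
        δ<j+δ+1 : ∀ {j} → δ < j + N.suc δ
        δ<j+δ+1 {j} = Eq.subst (δ <_) (Eq.sym (NP.+-suc j δ)) (N.s≤s (NP.m≤n+m δ j))
        from-top : ∀ n j → δ < j + n → slice P j ≈ₚ []
        from-top N.zero    j δ<j   = slice-high j (Eq.subst (δ <_) (NP.+-identityʳ j) δ<j)
        from-top (N.suc n) j δ<j+n = slice-step j (λ j′ j<j′ →
          from-top n j′ (NP.<-≤-trans (Eq.subst (δ <_) (NP.+-suc j n) δ<j+n) (NP.+-monoˡ-≤ n j<j′)))

    -- Multiplicity M at the points σ(b) survives in f^(β) ∘ σ as multiplicity M - |β| at b,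
    -- while its degree is at most l (D - |β|).
    hasse-subst-vanishes : ∀ {n d} (f : Poly n) (σ : Vec (Poly d) n) l D M (β : Monomial n) →
      (∀ i → Degree≤ (lookup σ i) l) → Degree≤ f D →
      (∀ ι → MultAtLeast f (map (λ s → eval s (gridPoint ι)) σ) M) →
      l N.* (D N.∸ ∣ β ∣ₘ) < (M N.∸ ∣ β ∣ₘ) N.* k → subst (hasse f β) σ ≈ₚ []
    hasse-subst-vanishes {d = d} f σ l D M β σ-deg f-deg f-mult bound =
      schwartzZippel d (subst (hasse f β) σ) (M N.∸ ∣ β ∣ₘ) (l N.* (D N.∸ ∣ β ∣ₘ)) P-deg bound P-ord
      where
        P-deg : Degree≤ (subst (hasse f β) σ) (l N.* (D N.∸ ∣ β ∣ₘ))
        P-deg = Eq.subst (Degree≤ (subst (hasse f β) σ)) (NP.*-comm (D N.∸ ∣ β ∣ₘ) l)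
          (degree≤-subst (hasse f β) σ l (D N.∸ ∣ β ∣ₘ) σ-deg (degree≤-hasse f D β f-deg))
        P-ord : ∀ ι → Order≥ (translate (gridPoint ι) (subst (hasse f β) σ)) (M N.∸ ∣ β ∣ₘ)
        P-ord ι = order≥-translate-subst (hasse f β) σ (gridPoint ι) (M N.∸ ∣ β ∣ₘ)
          (order≥-cong (≈ₚ-sym (translate-hasse f β σb))
            (order≥-hasse (translate σb f) M β (multAtLeast⇒order≥ f σb M (f-mult ι))))
          where σb = map (λ s → eval s (gridPoint ι)) σ

module FiniteFieldProperties {c ℓ} (F : FiniteField c ℓ) where
  open FiniteField F
  open CommutativeRing cring renaming (_+_ to _⊕_) hiding (zero)
  open Polynomials cring
  open PolynomialAlgebra cring

  *-cancelˡ-nonZero : AlmostLeftCancellative _≈_ 0# _*_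
  *-cancelˡ-nonZero x y z x≉0 xy≈xz with inverse x x≉0
  ... | x⁻¹ , xx⁻¹≈1 = begin
    y                ≈⟨ *-identityˡ y ⟨
    1# * y           ≈⟨ *-congʳ (trans (sym xx⁻¹≈1) (*-comm x x⁻¹)) ⟩
    (x⁻¹ * x) * y    ≈⟨ *-assoc x⁻¹ x y ⟩
    x⁻¹ * (x * y)    ≈⟨ *-congˡ xy≈xz ⟩
    x⁻¹ * (x * z)    ≈⟨ *-assoc x⁻¹ x z ⟨
    (x⁻¹ * x) * z    ≈⟨ *-congʳ (trans (sym xx⁻¹≈1) (*-comm x x⁻¹)) ⟨
    1# * z           ≈⟨ *-identityˡ z ⟩
    z                ∎
    where open ≈-Reasoning

  _≈?_ : ∀ x y → Dec (x ≈ y)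
  x ≈? y with complete x | complete y
  ... | i , x≈xᵢ | j , y≈xⱼ with i Fn.≟ j
  ...   | yes Eq.refl = yes (trans x≈xᵢ (sym y≈xⱼ))
  ...   | no i≢j      = no (λ x≈y → i≢j (distinct i j (trans (sym x≈xᵢ) (trans x≈y y≈xⱼ))))

  degreeAtMost⇒degree≤ : ∀ {m} (p : Poly m) D → DegreeAtMost p D → Degree≤ p D
  degreeAtMost⇒degree≤ p D p-deg α D<∣α∣ with coeff p α ≈? 0#
  ... | yes pα≈0 = pα≈0
  ... | no  pα≉0 = ⊥-elim (NP.<⇒≱ D<∣α∣ (p-deg α pα≉0))

lemma2p7 : ∀ {c ℓ} (F : FiniteField c ℓ) → IsPrimePower (FiniteField.size F) →
    let open FiniteField F
        open CommutativeRing cring renaming (_+_ to _⊕_)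
        open Polynomials cring
    in (d e : ℕ) → 1 ≤ d → 1 ≤ e →
       (l : ℕ) → 1 ≤ l → l < size →
       (g : Vec (Poly d) e) → (∀ i → HasDegree (lookup g i) l) →
       (ρ : Vec Carrier e) → (∀ i → ¬ (lookup ρ i ≈ 0#)) →
       (a : Vec Carrier (d + e)) →
       (k D M : ℕ) →
       (∀ ω → ω < k →
          (ℤ.+ l) ℤ.* ((ℤ.+ D) ℤ.- (ℤ.+ ω)) ℤ.< ((ℤ.+ M) ℤ.- (ℤ.+ ω)) ℤ.* (ℤ.+ size)) →
       (f : Poly (d + e)) → ¬ IsZero f → DegreeAtMost f D →
       (∀ (t : Vec Carrier d) →
          MultAtLeast f (zipWith _⊕_ a (t ++ zipWith (λ r gi → r * eval gi t) ρ g)) M) →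
       ∀ (β : Monomial (d + e)) → ∣ β ∣ₘ < k →
       IsZero (subst (hasse f β)
                 (zipWith _+ₚ_ (map const a)
                    (tabulate var ++ zipWith (λ r gi → const r *ₚ gi) ρ g)))
lemma2p7 F _ d e _ _ l 1≤l _ g g-deg ρ _ a k D M bound f _ f-deg f-mult β ∣β∣<k = at composite≈[]
  where
    open FiniteField F
    open CommutativeRing cring renaming (_+_ to _⊕_) hiding (zero)
    open Polynomials cring
    open PolynomialAlgebra cring
    open FiniteFieldProperties F
    open RootBounds cring *-cancelˡ-nonZero
    open Grid elems distinct
    f-deg′ : Degree≤ f D
    f-deg′ = degreeAtMost⇒degree≤ f D f-deg
    composite≈[] : subst (hasse f β) (curve a ρ g) ≈ₚ []
    composite≈[] with D N.<? ∣ β ∣ₘ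
    ... | yes D<∣β∣ = subst-cong (curve a ρ g) (hasse-vanishes-above-degree f D β f-deg′ D<∣β∣)
    ... | no  D≮∣β∣ = hasse-subst-vanishes f (curve a ρ g) l D M β
      (degree≤-curve a ρ g l 1≤l (λ j → degreeAtMost⇒degree≤ (lookup g j) l (proj₁ (g-deg j))))
      f-deg′
      (λ ι → multAtLeast-curve f a ρ g (gridPoint ι) M (f-mult (gridPoint ι)))
      (ℤ-bound⇒ℕ-bound l D M ∣ β ∣ₘ size (NP.≮⇒≥ D≮∣β∣) (bound ∣ β ∣ₘ ∣β∣<k))
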